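{- Let $(q_n(x))_{n\ge -1}$ be the polynomials defined by $q_{ -1}(x)=1$ and, for $k\ge -1$, $$q_{k+1}(x)=\bigl(2(k+1)x+1\bigr)q_k(x)+2x(1-x)q_k'(x).$$ For $n\ge 0$ let $F_n(x,y)$ be the bivariate Eulerian polynomial: $F_0(x,y)=1$ and $F_n(x,y)=\sum_{\pi\in\mathfrak S_n}x^{\mathrm{exc}(\pi)}y^{\mathrm{cyc}(\pi)}$ for $n>0$. Then, as formal power series in $t$, $$Q(x,t):=\sum_{n=0}^\infty q_{n-1}(x)\frac{t^n}{n!}=\left(\frac{1-x}{e^{2t(x-1)}-x}\right)^{1/2}=\sum_{n=0}^\infty 2^nF_n(x,1/2)\frac{t^n}{n!},$$ that is, $q_n(x)=2^{n+1}F_{n+1}(x,1/2)$ for every $n\ge -1$.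
   Context: $\mathfrak S_n$ is the set of permutations $\pi=\pi_1\cdots\pi_n$ of $\{1,\dots,n\}$; $\mathrm{exc}(\pi)=|\{i:\pi_i>i\}|$ is the number of excedances and $\mathrm{cyc}(\pi)$ is the number of cycles in the disjoint cycle decomposition of $\pi$. -}

module Defs where

open import Data.Bool using (Bool; true; false; _∧_; _∨_; not; if_then_else_)
open import Data.Nat as ℕ using (ℕ; zero; suc; _≡ᵇ_; _<ᵇ_; _≤ᵇ_)
open import Data.Fin using (Fin; toℕ)
open import Data.Vec using (Vec; []; _∷_; lookup)
open import Data.List using (List; []; _∷_; map; concatMap; filterᵇ; allFin; foldr; length; upTo)
open import Data.Integer as ℤ using (ℤ; +_)
open import Data.Rational as ℚ using (ℚ; 0ℚ; 1ℚ; ½)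
open import Data.Nat.Combinatorics using (_C_)
open import Relation.Binary.PropositionalEquality using (_≡_)
open import Data.Bool.ListAction using (and)

-- Univariate polynomials in x, as coefficient functions
-- (p j = coefficient of x^j).  Equality is coefficientwise.

infixl 6 _+ₚ_ _-ₚ_
infixl 7 _*ₚ_ _·ₚ_ _⋆_
infix 4 _≈ₚ_

Poly : Set
Poly = ℕ → ℤ

_≈ₚ_ : Poly → Poly → Set
p ≈ₚ r = ∀ j → p j ≡ r j

constP : ℤ → Poly
constP a zero    = a
constP a (suc j) = + 0

xP : Poly
xP 1 = + 1
xP _ = + 0

_+ₚ_ : Poly → Poly → Poly
(p +ₚ r) j = p j ℤ.+ r j

_-ₚ_ : Poly → Poly → Poly
(p -ₚ r) j = p j ℤ.- r j

sumℤ : List ℤ → ℤ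
sumℤ = foldr ℤ._+_ (+ 0)

_*ₚ_ : Poly → Poly → Poly
(p *ₚ r) j = sumℤ (map (λ i → p i ℤ.* r (j ℕ.∸ i)) (upTo (suc j)))

_·ₚ_ : ℤ → Poly → Poly
(a ·ₚ p) j = a ℤ.* p j

deriv : Poly → Poly
deriv p j = + (suc j) ℤ.* p (suc j)

powP : Poly → ℕ → Poly
powP p zero    = constP (+ 1)
powP p (suc n) = p *ₚ powP p n

-- The polynomials q_k, k ≥ -1, with index shifted by one:
--   qq n = q_{n-1}.
-- q_{-1} = 1,  q_{k+1} = (2(k+1)x + 1) q_k + 2x(1-x) q_k'.

qq : ℕ → Poly
qq zero    = constP (+ 1)
qq (suc m) =
  (((+ (2 ℕ.* m)) ·ₚ xP) +ₚ constP (+ 1)) *ₚ qq m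
  +ₚ (((+ 2) ·ₚ xP) *ₚ (constP (+ 1) -ₚ xP)) *ₚ deriv (qq m)

-- Permutations of {0,…,n-1} (0-based; excedances and cycles are
-- invariant under the shift i ↦ i+1), enumerated as the injective
-- words of length n over Fin n.

vecsOver : ∀ {A : Set} → List A → (m : ℕ) → List (Vec A m)
vecsOver xs zero    = [] ∷ []
vecsOver xs (suc m) = concatMap (λ a → map (a ∷_) (vecsOver xs m)) xs

_==ꟳ_ : ∀ {n} → Fin n → Fin n → Bool
i ==ꟳ j = toℕ i ≡ᵇ toℕ j

isInjective : ∀ {n} → Vec (Fin n) n → Bool
isInjective {n} v =
  and (concatMap (λ i → map (λ j → not (lookup v i ==ꟳ lookup v j) ∨ (i ==ꟳ j))
                            (allFin n)) (allFin n))

Sym : (n : ℕ) → List (Vec (Fin n) n)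
Sym n = filterᵇ isInjective (vecsOver (allFin n) n)

count : ∀ {A : Set} → (A → Bool) → List A → ℕ
count P xs = length (filterᵇ P xs)

exc : ∀ {n} → Vec (Fin n) n → ℕ
exc {n} π = count (λ i → toℕ i <ᵇ toℕ (lookup π i)) (allFin n)

iter : ∀ {n} → Vec (Fin n) n → ℕ → Fin n → Fin n
iter π zero    i = i
iter π (suc k) i = lookup π (iter π k i)

isCycleMin : ∀ {n} → Vec (Fin n) n → Fin n → Bool
isCycleMin {n} π i = and (map (λ k → toℕ i ≤ᵇ toℕ (iter π k i)) (upTo n))

-- cyc(π) = number of cycles = number of cycle minima
cyc : ∀ {n} → Vec (Fin n) n → ℕ
cyc {n} π = count (isCycleMin π) (allFin n)

-- Bivariate Eulerian polynomial F_n(x,y), evaluated at y ∈ ℚ, as a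
-- polynomial in x with rational coefficients:
--   coefficient of x^j in F_n(x,y) = Σ_{π ∈ 𝔖_n, exc π = j} y^{cyc π},
-- and F_0(x,y) = 1.

powℚ : ℚ → ℕ → ℚ
powℚ y zero    = 1ℚ
powℚ y (suc n) = y ℚ.* powℚ y n

sumℚ : List ℚ → ℚ
sumℚ = foldr ℚ._+_ 0ℚ

Fcoeff : ℕ → ℚ → ℕ → ℚ
Fcoeff zero    y zero    = 1ℚ
Fcoeff zero    y (suc j) = 0ℚ
Fcoeff (suc n) y j =
  sumℚ (map (λ π → powℚ y (cyc π)) (filterᵇ (λ π → exc π ≡ᵇ j) (Sym (suc n))))

-- Exponential generating functions in t with coefficients in ℤ[x]:
-- a sequence a : ℕ → Poly stands for Σ_n a n t^n/n!.
-- Product of EGFs: (a ⋆ b) n = Σ_k C(n,k) a k b (n-k).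

_⋆_ : (ℕ → Poly) → (ℕ → Poly) → (ℕ → Poly)
(a ⋆ b) n j =
  sumℤ (map (λ k → ((+ (n C k)) ·ₚ (a k *ₚ b (n ℕ.∸ k))) j) (upTo (suc n)))

-- EGF of e^{2t(x-1)} : n-th coefficient (2(x-1))^n
expEGF : ℕ → Poly
expEGF n = powP (((+ 2) ·ₚ xP) -ₚ constP (+ 2)) n

constEGF : Poly → ℕ → Poly
constEGF c zero    = c
constEGF c (suc n) = constP (+ 0)

Q : ℕ → Poly
Q = qq

-- The recurrence for qₙ says that Q solves ∂t Q = 𝓛 1 Q, where
-- 𝓛 α a = α a + 2x t∂t a + 2x(1-x) ∂x a. As t∂t and ∂x are derivations, a product of solutions
-- for α and β solves the equation for α + β; e^{2t(x-1)} solves it for 2x - 2, and multiplying a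
-- solution by x also adds 2x - 2 to α. So H = Q² e^{2t(x-1)} - x Q² solves it for α = 2x, and its
-- constant term 1 - x is annihilated by 𝓛 2x; hence H = 1 - x.
--
-- Every permutation of {0,…,n} arises exactly once from a permutation σ of {0,…,n-1}, by adding
-- n as a fixed point (one more cycle) or inserting it after some i in its cycle (one more
-- excedance unless σ(i) > i). This gives [xʲ]Fₙ₊₁ = (y + j)[xʲ]Fₙ + (n - j + 1)[xʲ⁻¹]Fₙ, which at
-- y = ½, multiplied by 2ⁿ⁺¹, is the coefficient form of the recurrence for qₙ.
module Submission where

module Summation where

  open import Data.Nat as ℕ using (ℕ; zero; suc; _∸_; _<_)
  import Data.Nat.Properties as ℕP
  open import Data.Integer using (ℤ; +_; _+_; _*_)
  import Data.Integer.Properties as ℤP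
  open import Data.List using (map; upTo; applyUpTo)
  open import Relation.Binary.PropositionalEquality
  open import Function using (_∘_; id)
  open import Relation.Nullary using (yes; no)
  open import Data.Integer.Tactic.RingSolver using (solve-∀)
  open import Defs using (sumℤ)

  ∑ : (ℕ → ℤ) → ℕ → ℤ
  ∑ f zero    = + 0
  ∑ f (suc n) = ∑ f n + f n

  ∑-head : ∀ (f : ℕ → ℤ) n → ∑ f (suc n) ≡ f 0 + ∑ (f ∘ suc) n
  ∑-head f zero    = trans (ℤP.+-identityˡ (f 0)) (sym (ℤP.+-identityʳ (f 0)))
  ∑-head f (suc n) = trans (cong (_+ f (suc n)) (∑-head f n)) (ℤP.+-assoc (f 0) _ _)

  sumℤ-applyUpTo : ∀ (f : ℕ → ℤ) (g : ℕ → ℕ) n → sumℤ (map f (applyUpTo g n)) ≡ ∑ (f ∘ g) n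
  sumℤ-applyUpTo f g zero    = refl
  sumℤ-applyUpTo f g (suc n) =
    trans (cong (_+_ (f (g 0))) (sumℤ-applyUpTo f (g ∘ suc) n)) (sym (∑-head (f ∘ g) n))

  sumℤ-upTo : ∀ (f : ℕ → ℤ) n → sumℤ (map f (upTo n)) ≡ ∑ f n
  sumℤ-upTo f = sumℤ-applyUpTo f id

  ∑-cong-< : ∀ {f g : ℕ → ℤ} n → (∀ i → i < n → f i ≡ g i) → ∑ f n ≡ ∑ g n
  ∑-cong-< zero    eq = refl
  ∑-cong-< (suc n) eq = cong₂ _+_ (∑-cong-< n (λ i i<n → eq i (ℕP.m<n⇒m<1+n i<n))) (eq n ℕP.≤-refl)

  ∑-cong : ∀ {f g : ℕ → ℤ} n → (∀ i → f i ≡ g i) → ∑ f n ≡ ∑ g n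
  ∑-cong n eq = ∑-cong-< n (λ i _ → eq i)

  ∑-distrib-+ : ∀ (f g : ℕ → ℤ) n → ∑ (λ i → f i + g i) n ≡ ∑ f n + ∑ g n
  ∑-distrib-+ f g zero    = refl
  ∑-distrib-+ f g (suc n) =
    trans (cong (_+ (f n + g n)) (∑-distrib-+ f g n)) (interchange (∑ f n) (∑ g n) (f n) (g n))
    where
    interchange : ∀ a b c d → (a + b) + (c + d) ≡ (a + c) + (b + d)
    interchange = solve-∀

  ∑-distribˡ-* : ∀ c (f : ℕ → ℤ) n → c * ∑ f n ≡ ∑ (λ i → c * f i) n
  ∑-distribˡ-* c f zero    = ℤP.*-zeroʳ c
  ∑-distribˡ-* c f (suc n) =
    trans (ℤP.*-distribˡ-+ c (∑ f n) (f n)) (cong (_+ c * f n) (∑-distribˡ-* c f n))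

  ∑-distribʳ-* : ∀ c (f : ℕ → ℤ) n → ∑ f n * c ≡ ∑ (λ i → f i * c) n
  ∑-distribʳ-* c f n =
    trans (ℤP.*-comm (∑ f n) c) (trans (∑-distribˡ-* c f n) (∑-cong n (λ i → ℤP.*-comm c (f i))))

  ∑-zero : ∀ {f : ℕ → ℤ} n → (∀ i → i < n → f i ≡ + 0) → ∑ f n ≡ + 0
  ∑-zero {f} n eq = trans (∑-cong-< n eq) (∑-0 n)
    where
    ∑-0 : ∀ n → ∑ (λ _ → + 0) n ≡ + 0
    ∑-0 zero    = refl
    ∑-0 (suc n) = trans (ℤP.+-identityʳ _) (∑-0 n)

  ∑-reverse : ∀ (f : ℕ → ℤ) n → ∑ f n ≡ ∑ (λ i → f (n ∸ suc i)) n
  ∑-reverse f zero    = refl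
  ∑-reverse f (suc n) = begin
    ∑ f n + f n                          ≡⟨ cong (_+ f n) (∑-reverse f n) ⟩
    ∑ (λ i → f (n ∸ suc i)) n + f n      ≡⟨ ℤP.+-comm _ (f n) ⟩
    f n + ∑ (λ i → f (n ∸ suc i)) n      ≡⟨ ∑-head (λ i → f (suc n ∸ suc i)) n ⟨
    ∑ (λ i → f (suc n ∸ suc i)) (suc n)  ∎
    where open ≡-Reasoning

  ∑-select : ∀ (f : ℕ → ℤ) n a → a < n → (∀ i → i < n → i ≢ a → f i ≡ + 0) → ∑ f n ≡ f a
  ∑-select f (suc n) a a<1+n vanish with a ℕ.≟ n
  ... | yes refl = trans (cong (_+ f a) (∑-zero n (λ i i<n → vanish i (ℕP.m<n⇒m<1+n i<n) (ℕP.<⇒≢ i<n))))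
                         (ℤP.+-identityˡ (f a))
  ... | no a≢n   = trans (cong (_+_ (∑ f n)) (vanish n ℕP.≤-refl (a≢n ∘ sym)))
                   (trans (ℤP.+-identityʳ _)
                          (∑-select f n a (ℕP.≤∧≢⇒< (ℕP.≤-pred a<1+n) a≢n)
                                    (λ i i<n → vanish i (ℕP.m<n⇒m<1+n i<n))))

  ∑-triangle : ∀ (f : ℕ → ℕ → ℤ) n →
    ∑ (λ m → ∑ (λ i → f i m) (suc m)) n ≡ ∑ (λ i → ∑ (λ a → f i (i ℕ.+ a)) (n ∸ i)) n
  ∑-triangle f zero    = refl
  ∑-triangle f (suc n) = begin
    ∑ (λ m → ∑ (λ i → f i m) (suc m)) n + (∑ (λ i → f i n) n + f n n)
      ≡⟨ cong (_+ (∑ (λ i → f i n) n + f n n)) (∑-triangle f n) ⟩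
    ∑ row n + (∑ (λ i → f i n) n + f n n)
      ≡⟨ ℤP.+-assoc (∑ row n) _ _ ⟨
    (∑ row n + ∑ (λ i → f i n) n) + f n n
      ≡⟨ cong₂ _+_ (∑-distrib-+ row (λ i → f i n) n) (cong (f n) (ℕP.+-identityʳ n)) ⟨
    ∑ (λ i → row i + f i n) n + f n (n ℕ.+ 0)
      ≡⟨ cong₂ _+_ (∑-cong-< n extend) (ℤP.+-identityˡ _) ⟨
    ∑ (λ i → ∑ (λ a → f i (i ℕ.+ a)) (suc n ∸ i)) n + ∑ (λ a → f n (n ℕ.+ a)) 1
      ≡⟨ cong (λ k → ∑ (λ i → ∑ (λ a → f i (i ℕ.+ a)) (suc n ∸ i)) n + ∑ (λ a → f n (n ℕ.+ a)) k)
              (ℕP.m+n∸n≡m 1 n) ⟨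
    ∑ (λ i → ∑ (λ a → f i (i ℕ.+ a)) (suc n ∸ i)) (suc n) ∎
    where
    open ≡-Reasoning
    row : ℕ → ℤ
    row i = ∑ (λ a → f i (i ℕ.+ a)) (n ∸ i)
    extend : ∀ i → i < n → ∑ (λ a → f i (i ℕ.+ a)) (suc n ∸ i) ≡ row i + f i n
    extend i i<n = trans (cong (∑ (λ a → f i (i ℕ.+ a))) (ℕP.+-∸-assoc 1 (ℕP.<⇒≤ i<n)))
                         (cong (λ k → row i + f i k) (ℕP.m+[n∸m]≡n (ℕP.<⇒≤ i<n)))

module Polynomial where

  open import Data.Nat as ℕ using (ℕ; zero; suc; _∸_; _<_; z≤n; s≤s)
  import Data.Nat.Properties as ℕP
  open import Data.Integer as ℤ using (ℤ; +_; _+_; _*_; -_)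
  import Data.Integer.Properties as ℤP
  open import Data.Maybe.Base using (Maybe; just; nothing)
  open import Data.Product using (_,_)
  open import Relation.Binary.PropositionalEquality
  open import Relation.Nullary using (yes; no; contradiction)
  open import Algebra.Bundles using (CommutativeRing)
  import Algebra.Solver.Ring as RingSolver
  import Algebra.Solver.Ring.AlmostCommutativeRing as ACR
  open import Data.Integer.Tactic.RingSolver using (solve-∀)
  open import Defs
  open Summation

  *ₚ-coeff : ∀ p r j → (p *ₚ r) j ≡ ∑ (λ i → p i * r (j ∸ i)) (suc j)
  *ₚ-coeff p r j = sumℤ-upTo (λ i → p i * r (j ∸ i)) (suc j)

  -ₚ_ : Poly → Poly
  (-ₚ p) j = - p j

  0ₚ 1ₚ : Poly
  0ₚ = λ _ → + 0
  1ₚ = constP (+ 1)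

  *ₚ-cong-≈ₚ : ∀ {p p′ r r′} → p ≈ₚ p′ → r ≈ₚ r′ → p *ₚ r ≈ₚ p′ *ₚ r′
  *ₚ-cong-≈ₚ {p} {p′} {r} {r′} p≈p′ r≈r′ j =
    trans (*ₚ-coeff p r j)
          (trans (∑-cong (suc j) (λ i → cong₂ _*_ (p≈p′ i) (r≈r′ (j ∸ i)))) (sym (*ₚ-coeff p′ r′ j)))

  *ₚ-comm : ∀ p r → p *ₚ r ≈ₚ r *ₚ p
  *ₚ-comm p r j = begin
    (p *ₚ r) j                                   ≡⟨ *ₚ-coeff p r j ⟩
    ∑ (λ i → p i * r (j ∸ i)) (suc j)            ≡⟨ ∑-reverse _ (suc j) ⟩
    ∑ (λ i → p (j ∸ i) * r (j ∸ (j ∸ i))) (suc j) ≡⟨ ∑-cong-< (suc j) swap ⟩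
    ∑ (λ i → r i * p (j ∸ i)) (suc j)            ≡⟨ *ₚ-coeff r p j ⟨
    (r *ₚ p) j                                   ∎
    where
    open ≡-Reasoning
    swap : ∀ i → i < suc j → p (j ∸ i) * r (j ∸ (j ∸ i)) ≡ r i * p (j ∸ i)
    swap i i<1+j = trans (cong (λ k → p (j ∸ i) * r k) (ℕP.m∸[m∸n]≡n (ℕP.≤-pred i<1+j)))
                         (ℤP.*-comm (p (j ∸ i)) (r i))

  *ₚ-assoc : ∀ p r s → (p *ₚ r) *ₚ s ≈ₚ p *ₚ (r *ₚ s)
  *ₚ-assoc p r s j = begin
    ((p *ₚ r) *ₚ s) j
      ≡⟨ *ₚ-coeff (p *ₚ r) s j ⟩
    ∑ (λ m → (p *ₚ r) m * s (j ∸ m)) (suc j)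
      ≡⟨ ∑-cong (suc j) (λ m → trans (cong (_* s (j ∸ m)) (*ₚ-coeff p r m))
                                     (∑-distribʳ-* (s (j ∸ m)) _ (suc m))) ⟩
    ∑ (λ m → ∑ (λ i → p i * r (m ∸ i) * s (j ∸ m)) (suc m)) (suc j)
      ≡⟨ ∑-triangle (λ i m → p i * r (m ∸ i) * s (j ∸ m)) (suc j) ⟩
    ∑ (λ i → ∑ (λ a → p i * r ((i ℕ.+ a) ∸ i) * s (j ∸ (i ℕ.+ a))) (suc j ∸ i)) (suc j)
      ≡⟨ ∑-cong-< (suc j) inner ⟩
    ∑ (λ i → p i * (r *ₚ s) (j ∸ i)) (suc j)
      ≡⟨ *ₚ-coeff p (r *ₚ s) j ⟨
    (p *ₚ (r *ₚ s)) j ∎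
    where
    open ≡-Reasoning
    inner : ∀ i → i < suc j →
            ∑ (λ a → p i * r ((i ℕ.+ a) ∸ i) * s (j ∸ (i ℕ.+ a))) (suc j ∸ i) ≡ p i * (r *ₚ s) (j ∸ i)
    inner i i<1+j = begin
      ∑ (λ a → p i * r ((i ℕ.+ a) ∸ i) * s (j ∸ (i ℕ.+ a))) (suc j ∸ i)
        ≡⟨ cong (∑ _) (ℕP.+-∸-assoc 1 (ℕP.≤-pred i<1+j)) ⟩
      ∑ (λ a → p i * r ((i ℕ.+ a) ∸ i) * s (j ∸ (i ℕ.+ a))) (suc (j ∸ i))
        ≡⟨ ∑-cong (suc (j ∸ i)) (λ a →
             trans (cong₂ (λ u v → p i * r u * s v) (ℕP.m+n∸m≡n i a) (sym (ℕP.∸-+-assoc j i a)))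
                   (ℤP.*-assoc (p i) _ _)) ⟩
      ∑ (λ a → p i * (r a * s ((j ∸ i) ∸ a))) (suc (j ∸ i))
        ≡⟨ ∑-distribˡ-* (p i) _ (suc (j ∸ i)) ⟨
      p i * ∑ (λ a → r a * s ((j ∸ i) ∸ a)) (suc (j ∸ i))
        ≡⟨ cong (p i *_) (*ₚ-coeff r s (j ∸ i)) ⟨
      p i * (r *ₚ s) (j ∸ i) ∎

  *ₚ-distribˡ-+ₚ : ∀ p r s → p *ₚ (r +ₚ s) ≈ₚ p *ₚ r +ₚ p *ₚ s
  *ₚ-distribˡ-+ₚ p r s j =
    trans (*ₚ-coeff p (r +ₚ s) j)
    (trans (∑-cong (suc j) (λ i → ℤP.*-distribˡ-+ (p i) (r (j ∸ i)) (s (j ∸ i))))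
    (trans (∑-distrib-+ _ _ (suc j)) (sym (cong₂ _+_ (*ₚ-coeff p r j) (*ₚ-coeff p s j)))))

  *ₚ-distribʳ-+ₚ : ∀ p r s → (r +ₚ s) *ₚ p ≈ₚ r *ₚ p +ₚ s *ₚ p
  *ₚ-distribʳ-+ₚ p r s j =
    trans (*ₚ-comm (r +ₚ s) p j)
    (trans (*ₚ-distribˡ-+ₚ p r s j) (cong₂ _+_ (*ₚ-comm p r j) (*ₚ-comm p s j)))

  *ₚ-identityˡ : ∀ p → 1ₚ *ₚ p ≈ₚ p
  *ₚ-identityˡ p j =
    trans (*ₚ-coeff 1ₚ p j) (trans (∑-select _ (suc j) 0 (s≤s z≤n) vanish) (ℤP.*-identityˡ (p j)))
    where
    vanish : ∀ i → i < suc j → i ≢ 0 → 1ₚ i * p (j ∸ i) ≡ + 0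
    vanish zero    _ i≢0 = contradiction refl i≢0
    vanish (suc i) _ _   = refl

  -- Unlike the function type p ≈ₚ r, the record determines p and r, so they can be inferred from proofs.
  infix 4 _≃_
  record _≃_ (p r : Poly) : Set where
    constructor mk≃
    field coeffs : p ≈ₚ r
  open _≃_ public

  ℤ[x] : CommutativeRing _ _
  ℤ[x] = record
    { Carrier = Poly ; _≈_ = _≃_ ; _+_ = _+ₚ_ ; _*_ = _*ₚ_ ; -_ = -ₚ_ ; 0# = 0ₚ ; 1# = 1ₚ
    ; isCommutativeRing = record
      { isRing = record
        { +-isAbelianGroup = record
          { isGroup = record
            { isMonoid = record
              { isSemigroup = record
                { isMagma = record
                  { isEquivalence = record
                    { refl  = mk≃ (λ _ → refl)
                    ; sym   = λ e → mk≃ (λ j → sym (coeffs e j))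
                    ; trans = λ e f → mk≃ (λ j → trans (coeffs e j) (coeffs f j)) }
                  ; ∙-cong = λ e f → mk≃ (λ j → cong₂ _+_ (coeffs e j) (coeffs f j)) }
                ; assoc = λ p r s → mk≃ λ j → ℤP.+-assoc (p j) (r j) (s j) }
              ; identity = (λ p → mk≃ λ j → ℤP.+-identityˡ (p j)) , (λ p → mk≃ λ j → ℤP.+-identityʳ (p j)) }
            ; inverse = (λ p → mk≃ λ j → ℤP.+-inverseˡ (p j)) , (λ p → mk≃ λ j → ℤP.+-inverseʳ (p j))
            ; ⁻¹-cong = λ e → mk≃ (λ j → cong -_ (coeffs e j)) }
          ; comm = λ p r → mk≃ λ j → ℤP.+-comm (p j) (r j) }
        ; *-cong = λ e f → mk≃ (*ₚ-cong-≈ₚ (coeffs e) (coeffs f))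
        ; *-assoc = λ p r s → mk≃ (*ₚ-assoc p r s)
        ; *-identity = (λ p → mk≃ (*ₚ-identityˡ p))
                     , (λ p → mk≃ λ j → trans (*ₚ-comm p 1ₚ j) (*ₚ-identityˡ p j))
        ; distrib = (λ p r s → mk≃ (*ₚ-distribˡ-+ₚ p r s)) , (λ p r s → mk≃ (*ₚ-distribʳ-+ₚ p r s)) }
      ; *-comm = λ p r → mk≃ (*ₚ-comm p r) } }

  open CommutativeRing ℤ[x] public
    using (setoid; +-identityʳ; -‿cong)
    renaming (refl to ≃-refl; sym to ≃-sym; trans to ≃-trans; +-cong to +ₚ-cong; *-cong to *ₚ-cong)

  constP-+ : ∀ a b → constP (a + b) ≈ₚ constP a +ₚ constP b
  constP-+ a b zero    = refl
  constP-+ a b (suc j) = refl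

  constP-* : ∀ a b → constP (a * b) ≈ₚ constP a *ₚ constP b
  constP-* a b zero    = sym (trans (*ₚ-coeff (constP a) (constP b) 0) (ℤP.+-identityˡ _))
  constP-* a b (suc j) = sym (trans (*ₚ-coeff (constP a) (constP b) (suc j)) (∑-zero (suc (suc j)) vanish))
    where
    vanish : ∀ i → i < suc (suc j) → constP a i * constP b (suc j ∸ i) ≡ + 0
    vanish zero    _ = ℤP.*-zeroʳ a
    vanish (suc i) _ = refl

  private
    constP-homomorphism : ACR._-Raw-AlmostCommutative⟶_
      (CommutativeRing.rawRing ℤP.+-*-commutativeRing) (ACR.fromCommutativeRing ℤ[x])
    constP-homomorphism = record
      { ⟦_⟧    = constP
      ; +-homo = λ a b → mk≃ (constP-+ a b)
      ; *-homo = λ a b → mk≃ (constP-* a b)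
      ; -‿homo = λ a → mk≃ (λ { zero → refl ; (suc j) → refl })
      ; 0-homo = mk≃ (λ { zero → refl ; (suc j) → refl })
      ; 1-homo = mk≃ (λ j → refl) }

    constP-≟ : ∀ a b → Maybe (constP a ≃ constP b)
    constP-≟ a b with a ℤ.≟ b
    ... | yes refl = just ≃-refl
    ... | no _     = nothing

  open RingSolver (CommutativeRing.rawRing ℤP.+-*-commutativeRing) (ACR.fromCommutativeRing ℤ[x])
                  constP-homomorphism constP-≟ public
    using (solve; _:=_; con; _:+_; _:*_; _:-_)

  *ₚ-congˡ : ∀ p {r r′} → r ≃ r′ → p *ₚ r ≃ p *ₚ r′
  *ₚ-congˡ p e = *ₚ-cong (≃-refl {p}) e

  *ₚ-congʳ : ∀ p {r r′} → r ≃ r′ → r *ₚ p ≃ r′ *ₚ p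
  *ₚ-congʳ p e = *ₚ-cong e (≃-refl {p})

  +ₚ-congˡ : ∀ p {r r′} → r ≃ r′ → p +ₚ r ≃ p +ₚ r′
  +ₚ-congˡ p e = +ₚ-cong (≃-refl {p}) e

  +ₚ-congʳ : ∀ p {r r′} → r ≃ r′ → r +ₚ p ≃ r′ +ₚ p
  +ₚ-congʳ p e = +ₚ-cong e (≃-refl {p})

  constP-0 : constP (+ 0) ≃ 0ₚ
  constP-0 = mk≃ λ { zero → refl ; (suc j) → refl }

  ·ₚ-constP : ∀ c p → c ·ₚ p ≃ constP c *ₚ p
  ·ₚ-constP c p = mk≃ λ j → sym (trans (*ₚ-coeff (constP c) p j)
    (trans (∑-head _ j) (trans (cong (_+_ (c * p j)) (∑-zero j (λ _ _ → refl))) (ℤP.+-identityʳ _))))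

  ·ₚ-cong : ∀ c {p r} → p ≃ r → c ·ₚ p ≃ c ·ₚ r
  ·ₚ-cong c e = mk≃ λ j → cong (c *_) (coeffs e j)

  ·ₚ-distrib-+ₚ : ∀ c p r → c ·ₚ (p +ₚ r) ≃ c ·ₚ p +ₚ c ·ₚ r
  ·ₚ-distrib-+ₚ c p r = mk≃ λ j → ℤP.*-distribˡ-+ c (p j) (r j)

  +-distrib-·ₚ : ∀ c d p → (c + d) ·ₚ p ≃ c ·ₚ p +ₚ d ·ₚ p
  +-distrib-·ₚ c d p = mk≃ λ j → ℤP.*-distribʳ-+ (p j) c d

  deriv-cong : ∀ {p r} → p ≃ r → deriv p ≃ deriv r
  deriv-cong e = mk≃ λ j → cong (+ suc j *_) (coeffs e (suc j))

  deriv--ₚ : ∀ p r → deriv (p -ₚ r) ≃ deriv p -ₚ deriv r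
  deriv--ₚ p r = mk≃ λ j →
    trans (ℤP.*-distribˡ-+ (+ suc j) (p (suc j)) (- r (suc j)))
          (cong (_+_ (deriv p j)) (sym (ℤP.neg-distribʳ-* (+ suc j) (r (suc j)))))

  deriv-constP : ∀ c → deriv (constP c) ≃ 0ₚ
  deriv-constP c = mk≃ λ j → ℤP.*-zeroʳ (+ suc j)

  deriv-xP : deriv xP ≃ 1ₚ
  deriv-xP = mk≃ λ { zero → refl ; (suc j) → ℤP.*-zeroʳ (+ suc (suc j)) }

  deriv-·ₚ : ∀ c p → deriv (c ·ₚ p) ≃ c ·ₚ deriv p
  deriv-·ₚ c p = mk≃ λ j → swap (+ suc j) c (p (suc j))
    where
    swap : ∀ a b x → a * (b * x) ≡ b * (a * x)
    swap = solve-∀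

  -- With k + (j+1-k) = j+1, each term of the coefficient of x^(j+1) splits into two Leibniz terms.
  deriv-*ₚ : ∀ p r → deriv (p *ₚ r) ≃ deriv p *ₚ r +ₚ p *ₚ deriv r
  deriv-*ₚ p r = mk≃ λ j → begin
    + suc j * (p *ₚ r) (suc j)
      ≡⟨ cong (+ suc j *_) (*ₚ-coeff p r (suc j)) ⟩
    + suc j * ∑ (λ i → p i * r (suc j ∸ i)) (suc (suc j))
      ≡⟨ ∑-distribˡ-* (+ suc j) _ (suc (suc j)) ⟩
    ∑ (λ i → + suc j * (p i * r (suc j ∸ i))) (suc (suc j))
      ≡⟨ ∑-cong-< (suc (suc j)) (split j) ⟩
    ∑ (λ i → (+ i * p i) * r (suc j ∸ i) + p i * (+ (suc j ∸ i) * r (suc j ∸ i))) (suc (suc j))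
      ≡⟨ ∑-distrib-+ _ _ (suc (suc j)) ⟩
    ∑ (λ i → (+ i * p i) * r (suc j ∸ i)) (suc (suc j))
      + ∑ (λ i → p i * (+ (suc j ∸ i) * r (suc j ∸ i))) (suc (suc j))
      ≡⟨ cong₂ _+_ (drop-first j) (drop-last j) ⟩
    ∑ (λ i → deriv p i * r (j ∸ i)) (suc j) + ∑ (λ i → p i * (+ (suc j ∸ i) * r (suc j ∸ i))) (suc j)
      ≡⟨ cong (_+_ (∑ (λ i → deriv p i * r (j ∸ i)) (suc j))) (∑-cong-< (suc j) (realign j)) ⟩
    ∑ (λ i → deriv p i * r (j ∸ i)) (suc j) + ∑ (λ i → p i * deriv r (j ∸ i)) (suc j)
      ≡⟨ cong₂ _+_ (*ₚ-coeff (deriv p) r j) (*ₚ-coeff p (deriv r) j) ⟨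
    (deriv p *ₚ r +ₚ p *ₚ deriv r) j ∎
    where
    open ≡-Reasoning
    split : ∀ j i → i < suc (suc j) →
            + suc j * (p i * r (suc j ∸ i)) ≡ (+ i * p i) * r (suc j ∸ i) + p i * (+ (suc j ∸ i) * r (suc j ∸ i))
    split j i i≤1+j =
      trans (cong (λ k → + k * (p i * r (suc j ∸ i))) (sym (ℕP.m+[n∸m]≡n (ℕP.≤-pred i≤1+j))))
      (trans (cong (_* (p i * r (suc j ∸ i))) (ℤP.pos-+ i (suc j ∸ i)))
             (leibniz (+ i) (+ (suc j ∸ i)) (p i) (r (suc j ∸ i))))
      where
      leibniz : ∀ a b c d → (a + b) * (c * d) ≡ (a * c) * d + c * (b * d)
      leibniz = solve-∀
    drop-first : ∀ j → ∑ (λ i → (+ i * p i) * r (suc j ∸ i)) (suc (suc j)) ≡ ∑ (λ i → deriv p i * r (j ∸ i)) (suc j)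
    drop-first j = trans (∑-head (λ i → (+ i * p i) * r (suc j ∸ i)) (suc j))
      (trans (cong (λ z → z * r (suc j) + ∑ (λ i → deriv p i * r (j ∸ i)) (suc j)) (ℤP.*-zeroˡ (p 0)))
             (ℤP.+-identityˡ _))
    drop-last : ∀ j → ∑ (λ i → p i * (+ (suc j ∸ i) * r (suc j ∸ i))) (suc (suc j))
                    ≡ ∑ (λ i → p i * (+ (suc j ∸ i) * r (suc j ∸ i))) (suc j)
    drop-last j = trans (cong (_+_ (∑ (λ i → p i * (+ (suc j ∸ i) * r (suc j ∸ i))) (suc j)))
                              (trans (cong (λ k → p (suc j) * (+ k * r k)) (ℕP.n∸n≡0 (suc j)))
                                     (ℤP.*-zeroʳ (p (suc j)))))
                        (ℤP.+-identityʳ _)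
    realign : ∀ j i → i < suc j → p i * (+ (suc j ∸ i) * r (suc j ∸ i)) ≡ p i * deriv r (j ∸ i)
    realign j i i<1+j = cong (λ k → p i * (+ k * r k)) (ℕP.+-∸-assoc 1 (ℕP.≤-pred i<1+j))

  constP-*ₚ-coeff : ∀ c p j → (constP c *ₚ p) j ≡ c * p j
  constP-*ₚ-coeff c p j = sym (coeffs (·ₚ-constP c p) j)

  xP-*ₚ-coeff-zero : ∀ p → (xP *ₚ p) 0 ≡ + 0
  xP-*ₚ-coeff-zero p = *ₚ-coeff xP p 0

  xP-*ₚ-coeff-suc : ∀ p i → (xP *ₚ p) (suc i) ≡ p i
  xP-*ₚ-coeff-suc p i =
    trans (*ₚ-coeff xP p (suc i)) (trans (∑-select _ (suc (suc i)) 1 (s≤s (s≤s z≤n)) vanish) (ℤP.*-identityˡ (p i)))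
    where
    vanish : ∀ k → k < suc (suc i) → k ≢ 1 → xP k * p (suc i ∸ k) ≡ + 0
    vanish zero          _ _   = refl
    vanish (suc zero)    _ k≢1 = contradiction refl k≢1
    vanish (suc (suc k)) _ _   = refl

  xP-*ₚ-deriv-coeff : ∀ p i → (xP *ₚ deriv p) i ≡ + i * p i
  xP-*ₚ-deriv-coeff p zero    = xP-*ₚ-coeff-zero (deriv p)
  xP-*ₚ-deriv-coeff p (suc i) = xP-*ₚ-coeff-suc (deriv p) i

module ExponentialGeneratingFunction where

  open import Data.Nat using (ℕ; zero; suc; _∸_; _<_)
  import Data.Nat.Properties as ℕP
  open import Data.Nat.Combinatorics using (_C_; k>n⇒nCk≡0; nCk+nC[k+1]≡[n+1]C[k+1])
  open import Data.Integer using (ℤ; +_; _+_; _*_)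
  import Data.Integer.Properties as ℤP
  open import Relation.Binary.PropositionalEquality as ≡ using (_≡_; cong)
  open import Function using (_∘_)
  open import Defs
  open Summation
  open Polynomial
  open import Relation.Binary.Reasoning.Setoid setoid

  EGF : Set
  EGF = ℕ → Poly

  infix 4 _≋_
  _≋_ : EGF → EGF → Set
  a ≋ b = ∀ n → a n ≃ b n

  infixl 6 _⊕_ _⊖_
  infixr 7 _∙_

  _⊕_ _⊖_ : EGF → EGF → EGF
  (a ⊕ b) n = a n +ₚ b n
  (a ⊖ b) n = a n -ₚ b n

  _∙_ : Poly → EGF → EGF
  (p ∙ a) n = p *ₚ a n

  ∂t t∂t ∂x : EGF → EGF
  ∂t a n  = a (suc n)
  t∂t a n = constP (+ n) *ₚ a n
  ∂x a n  = deriv (a n)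

  ∑ₚ : (ℕ → Poly) → ℕ → Poly
  ∑ₚ F n j = ∑ (λ k → F k j) n

  ⋆-term : EGF → EGF → ℕ → ℕ → Poly
  ⋆-term a b n k = (+ (n C k)) ·ₚ (a k *ₚ b (n ∸ k))

  ⋆-∑ₚ : ∀ a b n → (a ⋆ b) n ≃ ∑ₚ (⋆-term a b n) (suc n)
  ⋆-∑ₚ a b n = mk≃ λ j → sumℤ-upTo (λ k → ⋆-term a b n k j) (suc n)

  ∑ₚ-cong-< : ∀ {F G : ℕ → Poly} n → (∀ k → k < n → F k ≃ G k) → ∑ₚ F n ≃ ∑ₚ G n
  ∑ₚ-cong-< n e = mk≃ λ j → ∑-cong-< n (λ k k<n → coeffs (e k k<n) j)

  ∑ₚ-distrib-+ₚ : ∀ (F G : ℕ → Poly) n → ∑ₚ (λ k → F k +ₚ G k) n ≃ ∑ₚ F n +ₚ ∑ₚ G n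
  ∑ₚ-distrib-+ₚ F G n = mk≃ λ j → ∑-distrib-+ (λ k → F k j) (λ k → G k j) n

  ∑ₚ-head : ∀ (F : ℕ → Poly) n → ∑ₚ F (suc n) ≃ F 0 +ₚ ∑ₚ (F ∘ suc) n
  ∑ₚ-head F n = mk≃ λ j → ∑-head (λ k → F k j) n

  ∑ₚ-distribˡ-*ₚ : ∀ p (F : ℕ → Poly) n → p *ₚ ∑ₚ F n ≃ ∑ₚ (λ k → p *ₚ F k) n
  ∑ₚ-distribˡ-*ₚ p F zero    = mk≃ λ j → ≡.trans (*ₚ-coeff p 0ₚ j) (∑-zero (suc j) (λ i _ → ℤP.*-zeroʳ (p i)))
  ∑ₚ-distribˡ-*ₚ p F (suc n) =
    ≃-trans (mk≃ (*ₚ-distribˡ-+ₚ p (∑ₚ F n) (F n))) (+ₚ-congʳ (p *ₚ F n) (∑ₚ-distribˡ-*ₚ p F n))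

  deriv-∑ₚ : ∀ (F : ℕ → Poly) n → deriv (∑ₚ F n) ≃ ∑ₚ (λ k → deriv (F k)) n
  deriv-∑ₚ F n = mk≃ λ j → ∑-distribˡ-* (+ suc j) (λ k → F k (suc j)) n

  ·ₚ-*ₚ-comm : ∀ c p r → c ·ₚ (p *ₚ r) ≃ p *ₚ (c ·ₚ r)
  ·ₚ-*ₚ-comm c p r =
    ≃-trans (·ₚ-constP c (p *ₚ r))
    (≃-trans (solve 3 (λ C P R → C :* (P :* R) := P :* (C :* R)) ≃-refl (constP c) p r)
             (*ₚ-congˡ p (≃-sym (·ₚ-constP c r))))

  ⋆-cong : ∀ {a a′ b b′} → a ≋ a′ → b ≋ b′ → a ⋆ b ≋ a′ ⋆ b′
  ⋆-cong {a} {a′} {b} {b′} a≋a′ b≋b′ n =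
    ≃-trans (⋆-∑ₚ a b n)
    (≃-trans (∑ₚ-cong-< (suc n) (λ k _ → ·ₚ-cong (+ (n C k)) (*ₚ-cong (a≋a′ k) (b≋b′ (n ∸ k)))))
             (≃-sym (⋆-∑ₚ a′ b′ n)))

  ⋆-congʳ : ∀ {a a′} b → a ≋ a′ → a ⋆ b ≋ a′ ⋆ b
  ⋆-congʳ b a≋a′ = ⋆-cong a≋a′ (λ n → ≃-refl {b n})

  ⋆-congˡ : ∀ a {b b′} → b ≋ b′ → a ⋆ b ≋ a ⋆ b′
  ⋆-congˡ a b≋b′ = ⋆-cong (λ n → ≃-refl {a n}) b≋b′

  ⋆-distribʳ-⊕ : ∀ a a′ b → (a ⊕ a′) ⋆ b ≋ a ⋆ b ⊕ a′ ⋆ b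
  ⋆-distribʳ-⊕ a a′ b n =
    ≃-trans (⋆-∑ₚ (a ⊕ a′) b n)
    (≃-trans (∑ₚ-cong-< (suc n) (λ k _ →
               ≃-trans (·ₚ-cong (+ (n C k)) (mk≃ (*ₚ-distribʳ-+ₚ (b (n ∸ k)) (a k) (a′ k))))
                       (·ₚ-distrib-+ₚ (+ (n C k)) _ _)))
    (≃-trans (∑ₚ-distrib-+ₚ (⋆-term a b n) (⋆-term a′ b n) (suc n))
             (+ₚ-cong (≃-sym (⋆-∑ₚ a b n)) (≃-sym (⋆-∑ₚ a′ b n)))))

  ⋆-distribˡ-⊕ : ∀ a b b′ → a ⋆ (b ⊕ b′) ≋ a ⋆ b ⊕ a ⋆ b′
  ⋆-distribˡ-⊕ a b b′ n =
    ≃-trans (⋆-∑ₚ a (b ⊕ b′) n)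
    (≃-trans (∑ₚ-cong-< (suc n) (λ k _ →
               ≃-trans (·ₚ-cong (+ (n C k)) (mk≃ (*ₚ-distribˡ-+ₚ (a k) (b (n ∸ k)) (b′ (n ∸ k)))))
                       (·ₚ-distrib-+ₚ (+ (n C k)) _ _)))
    (≃-trans (∑ₚ-distrib-+ₚ (⋆-term a b n) (⋆-term a b′ n) (suc n))
             (+ₚ-cong (≃-sym (⋆-∑ₚ a b n)) (≃-sym (⋆-∑ₚ a b′ n)))))

  ∙-⋆ : ∀ p a b → (p ∙ a) ⋆ b ≋ p ∙ (a ⋆ b)
  ∙-⋆ p a b n =
    ≃-trans (⋆-∑ₚ (p ∙ a) b n)
    (≃-trans (∑ₚ-cong-< (suc n) (λ k _ →
               ≃-trans (·ₚ-cong (+ (n C k)) (mk≃ (*ₚ-assoc p (a k) (b (n ∸ k)))))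
                       (·ₚ-*ₚ-comm (+ (n C k)) p (a k *ₚ b (n ∸ k)))))
    (≃-trans (≃-sym (∑ₚ-distribˡ-*ₚ p (⋆-term a b n) (suc n))) (*ₚ-congˡ p (≃-sym (⋆-∑ₚ a b n)))))

  ⋆-∙ : ∀ p a b → a ⋆ (p ∙ b) ≋ p ∙ (a ⋆ b)
  ⋆-∙ p a b n =
    ≃-trans (⋆-∑ₚ a (p ∙ b) n)
    (≃-trans (∑ₚ-cong-< (suc n) (λ k _ →
               ≃-trans (·ₚ-cong (+ (n C k))
                         (solve 3 (λ A P B → A :* (P :* B) := P :* (A :* B)) ≃-refl (a k) p (b (n ∸ k))))
                       (·ₚ-*ₚ-comm (+ (n C k)) p (a k *ₚ b (n ∸ k)))))
    (≃-trans (≃-sym (∑ₚ-distribˡ-*ₚ p (⋆-term a b n) (suc n))) (*ₚ-congˡ p (≃-sym (⋆-∑ₚ a b n)))))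

  -- Pascal's rule splits the k-th term of (a ⋆ b)(n+1) into the (k-1)-th of ∂t a ⋆ b and the k-th of a ⋆ ∂t b.
  ∂t-⋆ : ∀ a b → ∂t (a ⋆ b) ≋ ∂t a ⋆ b ⊕ a ⋆ ∂t b
  ∂t-⋆ a b n = begin
    (a ⋆ b) (suc n)                              ≈⟨ ⋆-∑ₚ a b (suc n) ⟩
    ∑ₚ (⋆-term a b (suc n)) (suc (suc n))        ≈⟨ ∑ₚ-head (⋆-term a b (suc n)) (suc n) ⟩
    t₀ +ₚ ∑ₚ (⋆-term a b (suc n) ∘ suc) (suc n)  ≈⟨ +ₚ-congˡ t₀ (∑ₚ-cong-< (suc n) (λ k _ → pascal k)) ⟩
    t₀ +ₚ ∑ₚ (λ k → L k +ₚ R k) (suc n)          ≈⟨ +ₚ-congˡ t₀ (∑ₚ-distrib-+ₚ L R (suc n)) ⟩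
    t₀ +ₚ (∑ₚ L (suc n) +ₚ ∑ₚ R (suc n))
      ≈⟨ +ₚ-congˡ t₀ (+ₚ-congˡ (∑ₚ L (suc n)) (≃-trans (+ₚ-congˡ (∑ₚ R n) R-last) (+-identityʳ (∑ₚ R n)))) ⟩
    t₀ +ₚ (∑ₚ L (suc n) +ₚ ∑ₚ R n)
      ≈⟨ +ₚ-congˡ t₀ (+ₚ-congˡ (∑ₚ L (suc n)) (∑ₚ-cong-< n (λ k k<n →
           ·ₚ-cong (+ (n C suc k)) (*ₚ-congˡ (a (suc k))
             (mk≃ λ j → cong (λ m → b m j) (ℕP.+-∸-assoc 1 k<n)))))) ⟩
    t₀ +ₚ (∑ₚ L (suc n) +ₚ ∑ₚ (⋆-term a (∂t b) n ∘ suc) n)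
      ≈⟨ solve 3 (λ X Y Z → X :+ (Y :+ Z) := Y :+ (X :+ Z)) ≃-refl t₀ (∑ₚ L (suc n)) _ ⟩
    ∑ₚ L (suc n) +ₚ (t₀ +ₚ ∑ₚ (⋆-term a (∂t b) n ∘ suc) n)
      ≈⟨ +ₚ-cong (≃-sym (⋆-∑ₚ (∂t a) b n))
                 (≃-trans (≃-sym (∑ₚ-head (⋆-term a (∂t b) n) n)) (≃-sym (⋆-∑ₚ a (∂t b) n))) ⟩
    (∂t a ⋆ b ⊕ a ⋆ ∂t b) n ∎
    where
    t₀ = ⋆-term a b (suc n) 0
    L = ⋆-term (∂t a) b n
    R : ℕ → Poly
    R k = (+ (n C suc k)) ·ₚ (a (suc k) *ₚ b (n ∸ k))
    pascal : ∀ k → ⋆-term a b (suc n) (suc k) ≃ L k +ₚ R k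
    pascal k = ≃-trans (mk≃ λ j → cong (λ c → + c * (a (suc k) *ₚ b (n ∸ k)) j)
                                       (≡.sym (nCk+nC[k+1]≡[n+1]C[k+1] n k)))
               (≃-trans (mk≃ λ j → cong (_* (a (suc k) *ₚ b (n ∸ k)) j) (ℤP.pos-+ (n C k) (n C suc k)))
                        (+-distrib-·ₚ (+ (n C k)) (+ (n C suc k)) (a (suc k) *ₚ b (n ∸ k))))
    R-last : R n ≃ 0ₚ
    R-last = mk≃ λ j → cong (λ c → + c * (a (suc n) *ₚ b (n ∸ n)) j) (k>n⇒nCk≡0 (ℕP.n<1+n n))

  t∂t-⋆ : ∀ a b → t∂t (a ⋆ b) ≋ t∂t a ⋆ b ⊕ a ⋆ t∂t b
  t∂t-⋆ a b n = begin
    constP (+ n) *ₚ (a ⋆ b) n                     ≈⟨ *ₚ-congˡ (constP (+ n)) (⋆-∑ₚ a b n) ⟩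
    constP (+ n) *ₚ ∑ₚ (⋆-term a b n) (suc n)     ≈⟨ ∑ₚ-distribˡ-*ₚ (constP (+ n)) (⋆-term a b n) (suc n) ⟩
    ∑ₚ (λ k → constP (+ n) *ₚ ⋆-term a b n k) (suc n)
      ≈⟨ ∑ₚ-cong-< (suc n) term ⟩
    ∑ₚ (λ k → ⋆-term (t∂t a) b n k +ₚ ⋆-term a (t∂t b) n k) (suc n)
      ≈⟨ ∑ₚ-distrib-+ₚ (⋆-term (t∂t a) b n) (⋆-term a (t∂t b) n) (suc n) ⟩
    ∑ₚ (⋆-term (t∂t a) b n) (suc n) +ₚ ∑ₚ (⋆-term a (t∂t b) n) (suc n)
      ≈⟨ +ₚ-cong (≃-sym (⋆-∑ₚ (t∂t a) b n)) (≃-sym (⋆-∑ₚ a (t∂t b) n)) ⟩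
    (t∂t a ⋆ b ⊕ a ⋆ t∂t b) n ∎
    where
    term : ∀ k → k < suc n → constP (+ n) *ₚ ⋆-term a b n k ≃ ⋆-term (t∂t a) b n k +ₚ ⋆-term a (t∂t b) n k
    term k k<1+n = begin
      constP (+ n) *ₚ ⋆-term a b n k
        ≈⟨ *ₚ-cong n≃k+[n∸k] (·ₚ-constP c (a k *ₚ b (n ∸ k))) ⟩
      (constP (+ k) +ₚ constP (+ (n ∸ k))) *ₚ (constP c *ₚ (a k *ₚ b (n ∸ k)))
        ≈⟨ solve 5 (λ K M C A B → (K :+ M) :* (C :* (A :* B)) := C :* ((K :* A) :* B) :+ C :* (A :* (M :* B)))
                 ≃-refl (constP (+ k)) (constP (+ (n ∸ k))) (constP c) (a k) (b (n ∸ k)) ⟩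
      constP c *ₚ ((constP (+ k) *ₚ a k) *ₚ b (n ∸ k)) +ₚ constP c *ₚ (a k *ₚ (constP (+ (n ∸ k)) *ₚ b (n ∸ k)))
        ≈⟨ +ₚ-cong (≃-sym (·ₚ-constP c _)) (≃-sym (·ₚ-constP c _)) ⟩
      ⋆-term (t∂t a) b n k +ₚ ⋆-term a (t∂t b) n k ∎
      where
      c = + (n C k)
      n≃k+[n∸k] : constP (+ n) ≃ constP (+ k) +ₚ constP (+ (n ∸ k))
      n≃k+[n∸k] = mk≃ λ j → ≡.trans (cong (λ m → constP (+ m) j) (≡.sym (ℕP.m+[n∸m]≡n (ℕP.≤-pred k<1+n))))
                            (≡.trans (cong (λ z → constP z j) (ℤP.pos-+ k (n ∸ k))) (constP-+ (+ k) (+ (n ∸ k)) j))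

  ∂x-⋆ : ∀ a b → ∂x (a ⋆ b) ≋ ∂x a ⋆ b ⊕ a ⋆ ∂x b
  ∂x-⋆ a b n = begin
    deriv ((a ⋆ b) n)                                   ≈⟨ deriv-cong (⋆-∑ₚ a b n) ⟩
    deriv (∑ₚ (⋆-term a b n) (suc n))                   ≈⟨ deriv-∑ₚ (⋆-term a b n) (suc n) ⟩
    ∑ₚ (λ k → deriv (⋆-term a b n k)) (suc n)           ≈⟨ ∑ₚ-cong-< (suc n) term ⟩
    ∑ₚ (λ k → ⋆-term (∂x a) b n k +ₚ ⋆-term a (∂x b) n k) (suc n)
      ≈⟨ ∑ₚ-distrib-+ₚ (⋆-term (∂x a) b n) (⋆-term a (∂x b) n) (suc n) ⟩
    ∑ₚ (⋆-term (∂x a) b n) (suc n) +ₚ ∑ₚ (⋆-term a (∂x b) n) (suc n)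
      ≈⟨ +ₚ-cong (≃-sym (⋆-∑ₚ (∂x a) b n)) (≃-sym (⋆-∑ₚ a (∂x b) n)) ⟩
    (∂x a ⋆ b ⊕ a ⋆ ∂x b) n ∎
    where
    term : ∀ k → k < suc n → deriv (⋆-term a b n k) ≃ ⋆-term (∂x a) b n k +ₚ ⋆-term a (∂x b) n k
    term k _ = ≃-trans (deriv-·ₚ (+ (n C k)) (a k *ₚ b (n ∸ k)))
               (≃-trans (·ₚ-cong (+ (n C k)) (deriv-*ₚ (a k) (b (n ∸ k)))) (·ₚ-distrib-+ₚ (+ (n C k)) _ _))

  ⋆-zero : ∀ a b → (a ⋆ b) 0 ≃ a 0 *ₚ b 0
  ⋆-zero a b = ≃-trans (⋆-∑ₚ a b 0) (mk≃ λ j → ≡.trans (ℤP.+-identityˡ _) (ℤP.*-identityˡ _))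

module GeneratingFunctionIdentity where

  open import Data.Nat as ℕ using (ℕ; zero; suc)
  open import Data.Integer using (+_)
  import Data.Integer.Properties as ℤP
  open import Relation.Binary.PropositionalEquality as ≡ using (cong)
  open import Defs
  open Polynomial
  open ExponentialGeneratingFunction
  open import Relation.Binary.Reasoning.Setoid setoid

  2x 2x[1-x] : Poly
  2x      = constP (+ 2) *ₚ xP
  2x[1-x] = 2x *ₚ (1ₚ -ₚ xP)

  𝓛 : Poly → EGF → EGF
  𝓛 α a = α ∙ a ⊕ 2x ∙ t∂t a ⊕ 2x[1-x] ∙ ∂x a

  record Solves (α : Poly) (a : EGF) : Set where
    constructor solves
    field ∂t≋𝓛 : ∂t a ≋ 𝓛 α a
  open Solves

  ⋆-solves : ∀ {α β a b} → Solves α a → Solves β b → Solves (α +ₚ β) (a ⋆ b)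
  ⋆-solves {α} {β} {a} {b} a-solves b-solves = solves ∂t≋𝓛′
    where
    ∂t≋𝓛′ : ∂t (a ⋆ b) ≋ 𝓛 (α +ₚ β) (a ⋆ b)
    ∂t≋𝓛′ n = begin
      (a ⋆ b) (suc n)
        ≈⟨ ∂t-⋆ a b n ⟩
      (∂t a ⋆ b) n +ₚ (a ⋆ ∂t b) n
        ≈⟨ +ₚ-cong (⋆-congʳ b (∂t≋𝓛 a-solves) n) (⋆-congˡ a (∂t≋𝓛 b-solves) n) ⟩
      (𝓛 α a ⋆ b) n +ₚ (a ⋆ 𝓛 β b) n
        ≈⟨ +ₚ-cong (𝓛-⋆ α) (⋆-𝓛 β) ⟩
      (α *ₚ ab +ₚ 2x *ₚ A₁ +ₚ 2x[1-x] *ₚ B₁) +ₚ (β *ₚ ab +ₚ 2x *ₚ A₂ +ₚ 2x[1-x] *ₚ B₂)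
        ≈⟨ solve 8 (λ Al Be AB X A₁ A₂ B₁ B₂ →
             (Al :* AB :+ (con (+ 2) :* X) :* A₁ :+ ((con (+ 2) :* X) :* (con (+ 1) :- X)) :* B₁) :+
             (Be :* AB :+ (con (+ 2) :* X) :* A₂ :+ ((con (+ 2) :* X) :* (con (+ 1) :- X)) :* B₂)
             := (Al :+ Be) :* AB :+ (con (+ 2) :* X) :* (A₁ :+ A₂) :+ ((con (+ 2) :* X) :* (con (+ 1) :- X)) :* (B₁ :+ B₂))
             ≃-refl α β ab xP A₁ A₂ B₁ B₂ ⟩
      (α +ₚ β) *ₚ ab +ₚ 2x *ₚ (A₁ +ₚ A₂) +ₚ 2x[1-x] *ₚ (B₁ +ₚ B₂)
        ≈⟨ +ₚ-cong (+ₚ-congˡ ((α +ₚ β) *ₚ ab) (*ₚ-congˡ 2x (≃-sym (t∂t-⋆ a b n))))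
                   (*ₚ-congˡ 2x[1-x] (≃-sym (∂x-⋆ a b n))) ⟩
      𝓛 (α +ₚ β) (a ⋆ b) n ∎
      where
      ab = (a ⋆ b) n
      A₁ = (t∂t a ⋆ b) n
      A₂ = (a ⋆ t∂t b) n
      B₁ = (∂x a ⋆ b) n
      B₂ = (a ⋆ ∂x b) n
      𝓛-⋆ : ∀ α → (𝓛 α a ⋆ b) n ≃ α *ₚ ab +ₚ 2x *ₚ A₁ +ₚ 2x[1-x] *ₚ B₁
      𝓛-⋆ α = ≃-trans (⋆-distribʳ-⊕ (α ∙ a ⊕ 2x ∙ t∂t a) (2x[1-x] ∙ ∂x a) b n)
        (+ₚ-cong (≃-trans (⋆-distribʳ-⊕ (α ∙ a) (2x ∙ t∂t a) b n) (+ₚ-cong (∙-⋆ α a b n) (∙-⋆ 2x (t∂t a) b n)))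
                 (∙-⋆ 2x[1-x] (∂x a) b n))
      ⋆-𝓛 : ∀ β → (a ⋆ 𝓛 β b) n ≃ β *ₚ ab +ₚ 2x *ₚ A₂ +ₚ 2x[1-x] *ₚ B₂
      ⋆-𝓛 β = ≃-trans (⋆-distribˡ-⊕ a (β ∙ b ⊕ 2x ∙ t∂t b) (2x[1-x] ∙ ∂x b) n)
        (+ₚ-cong (≃-trans (⋆-distribˡ-⊕ a (β ∙ b) (2x ∙ t∂t b) n) (+ₚ-cong (⋆-∙ β a b n) (⋆-∙ 2x a (t∂t b) n)))
                 (⋆-∙ 2x[1-x] a (∂x b) n))

  ⊖-solves : ∀ {α a b} → Solves α a → Solves α b → Solves α (a ⊖ b)
  ⊖-solves {α} {a} {b} a-solves b-solves = solves ∂t≋𝓛′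
    where
    ∂t≋𝓛′ : ∂t (a ⊖ b) ≋ 𝓛 α (a ⊖ b)
    ∂t≋𝓛′ n = begin
      a (suc n) -ₚ b (suc n)
        ≈⟨ +ₚ-cong (∂t≋𝓛 a-solves n) (-‿cong (∂t≋𝓛 b-solves n)) ⟩
      𝓛 α a n -ₚ 𝓛 α b n
        ≈⟨ solve 7 (λ Al X A B K dA dB →
             (Al :* A :+ (con (+ 2) :* X) :* (K :* A) :+ ((con (+ 2) :* X) :* (con (+ 1) :- X)) :* dA)
             :- (Al :* B :+ (con (+ 2) :* X) :* (K :* B) :+ ((con (+ 2) :* X) :* (con (+ 1) :- X)) :* dB)
             := Al :* (A :- B) :+ (con (+ 2) :* X) :* (K :* (A :- B)) :+ ((con (+ 2) :* X) :* (con (+ 1) :- X)) :* (dA :- dB))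
             ≃-refl α xP (a n) (b n) (constP (+ n)) (deriv (a n)) (deriv (b n)) ⟩
      α *ₚ (a ⊖ b) n +ₚ 2x *ₚ t∂t (a ⊖ b) n +ₚ 2x[1-x] *ₚ (deriv (a n) -ₚ deriv (b n))
        ≈⟨ +ₚ-congˡ (α *ₚ (a ⊖ b) n +ₚ 2x *ₚ t∂t (a ⊖ b) n) (*ₚ-congˡ 2x[1-x] (≃-sym (deriv--ₚ (a n) (b n)))) ⟩
      𝓛 α (a ⊖ b) n ∎

  2x-2 : Poly
  2x-2 = (+ 2) ·ₚ xP -ₚ constP (+ 2)

  2x-2≃ : 2x -ₚ constP (+ 2) ≃ 2x-2
  2x-2≃ = +ₚ-congʳ (-ₚ constP (+ 2)) (≃-sym (·ₚ-constP (+ 2) xP))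

  xP∙-solves : ∀ {α a} → Solves α a → Solves (α +ₚ 2x-2) (xP ∙ a)
  xP∙-solves {α} {a} a-solves = solves ∂t≋𝓛′
    where
    ∂t≋𝓛′ : ∂t (xP ∙ a) ≋ 𝓛 (α +ₚ 2x-2) (xP ∙ a)
    ∂t≋𝓛′ n = begin
      xP *ₚ a (suc n)
        ≈⟨ *ₚ-congˡ xP (∂t≋𝓛 a-solves n) ⟩
      xP *ₚ 𝓛 α a n
        ≈⟨ solve 5 (λ Al X A K dA →
             X :* (Al :* A :+ (con (+ 2) :* X) :* (K :* A) :+ ((con (+ 2) :* X) :* (con (+ 1) :- X)) :* dA)
             := (Al :+ ((con (+ 2) :* X) :- con (+ 2))) :* (X :* A) :+ (con (+ 2) :* X) :* (K :* (X :* A))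
                :+ ((con (+ 2) :* X) :* (con (+ 1) :- X)) :* (con (+ 1) :* A :+ X :* dA))
             ≃-refl α xP (a n) (constP (+ n)) (deriv (a n)) ⟩
      (α +ₚ (2x -ₚ constP (+ 2))) *ₚ (xP *ₚ a n) +ₚ 2x *ₚ t∂t (xP ∙ a) n
        +ₚ 2x[1-x] *ₚ (1ₚ *ₚ a n +ₚ xP *ₚ deriv (a n))
        ≈⟨ +ₚ-cong (+ₚ-congʳ (2x *ₚ t∂t (xP ∙ a) n) (*ₚ-congʳ (xP *ₚ a n) (+ₚ-congˡ α 2x-2≃)))
                   (*ₚ-congˡ 2x[1-x] (≃-sym (deriv-x*ₚ (a n)))) ⟩
      𝓛 (α +ₚ 2x-2) (xP ∙ a) n ∎
      where
      deriv-x*ₚ : ∀ p → deriv (xP *ₚ p) ≃ 1ₚ *ₚ p +ₚ xP *ₚ deriv p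
      deriv-x*ₚ p = ≃-trans (deriv-*ₚ xP p) (+ₚ-congʳ (xP *ₚ deriv p) (*ₚ-congʳ p deriv-xP))

  qq-solves : Solves 1ₚ qq
  qq-solves = solves ∂t≋𝓛′
    where
    ∂t≋𝓛′ : ∂t qq ≋ 𝓛 1ₚ qq
    ∂t≋𝓛′ m = begin
      qq (suc m)
        ≈⟨ +ₚ-cong (*ₚ-congʳ (qq m) (+ₚ-congʳ 1ₚ (≃-trans (·ₚ-constP (+ (2 ℕ.* m)) xP) (*ₚ-congʳ xP 2m≃2*m))))
                   (*ₚ-congʳ (deriv (qq m)) (*ₚ-congʳ (1ₚ -ₚ xP) (·ₚ-constP (+ 2) xP))) ⟩
      ((constP (+ 2) *ₚ constP (+ m)) *ₚ xP +ₚ 1ₚ) *ₚ qq m +ₚ 2x[1-x] *ₚ deriv (qq m)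
        ≈⟨ solve 4 (λ M X Q dQ →
             ((con (+ 2) :* M) :* X :+ con (+ 1)) :* Q :+ ((con (+ 2) :* X) :* (con (+ 1) :- X)) :* dQ
             := con (+ 1) :* Q :+ (con (+ 2) :* X) :* (M :* Q) :+ ((con (+ 2) :* X) :* (con (+ 1) :- X)) :* dQ)
             ≃-refl (constP (+ m)) xP (qq m) (deriv (qq m)) ⟩
      𝓛 1ₚ qq m ∎
      where
      2m≃2*m : constP (+ (2 ℕ.* m)) ≃ constP (+ 2) *ₚ constP (+ m)
      2m≃2*m = mk≃ λ j → ≡.trans (cong (λ z → constP z j) (ℤP.pos-* 2 m)) (constP-* (+ 2) (+ m) j)

  -- Each (2x-2)ⁿ is homogeneous of degree n in x-1, hence n·(2x-2)ⁿ = (x-1)·∂x (2x-2)ⁿ.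
  t∂t-expEGF : ∀ n → t∂t expEGF n ≃ (xP -ₚ 1ₚ) *ₚ ∂x expEGF n
  t∂t-expEGF zero = ≃-trans (solve 1 (λ X → con (+ 0) :* con (+ 1) := (X :- con (+ 1)) :* con (+ 0)) ≃-refl xP)
                            (*ₚ-congˡ (xP -ₚ 1ₚ) (≃-trans constP-0 (≃-sym (deriv-constP (+ 1)))))
  t∂t-expEGF (suc n) = begin
    constP (+ suc n) *ₚ (2x-2 *ₚ E)
      ≈⟨ *ₚ-cong (mk≃ (constP-+ (+ 1) (+ n))) (*ₚ-congʳ E (≃-sym 2x-2≃)) ⟩
    (1ₚ +ₚ constP (+ n)) *ₚ ((2x -ₚ constP (+ 2)) *ₚ E)
      ≈⟨ solve 4 (λ N X E dE → (con (+ 1) :+ N) :* (((con (+ 2) :* X) :- con (+ 2)) :* E)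
                  := (X :- con (+ 1)) :* (con (+ 2) :* E) :+ ((con (+ 2) :* X) :- con (+ 2)) :* (N :* E))
               ≃-refl (constP (+ n)) xP E (deriv E) ⟩
    (xP -ₚ 1ₚ) *ₚ (constP (+ 2) *ₚ E) +ₚ (2x -ₚ constP (+ 2)) *ₚ (constP (+ n) *ₚ E)
      ≈⟨ +ₚ-congˡ ((xP -ₚ 1ₚ) *ₚ (constP (+ 2) *ₚ E)) (*ₚ-congˡ (2x -ₚ constP (+ 2)) (t∂t-expEGF n)) ⟩
    (xP -ₚ 1ₚ) *ₚ (constP (+ 2) *ₚ E) +ₚ (2x -ₚ constP (+ 2)) *ₚ ((xP -ₚ 1ₚ) *ₚ deriv E)
      ≈⟨ solve 3 (λ X E dE → (X :- con (+ 1)) :* (con (+ 2) :* E) :+ ((con (+ 2) :* X) :- con (+ 2)) :* ((X :- con (+ 1)) :* dE)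
                  := (X :- con (+ 1)) :* (con (+ 2) :* E :+ ((con (+ 2) :* X) :- con (+ 2)) :* dE))
               ≃-refl xP E (deriv E) ⟩
    (xP -ₚ 1ₚ) *ₚ (constP (+ 2) *ₚ E +ₚ (2x -ₚ constP (+ 2)) *ₚ deriv E)
      ≈⟨ *ₚ-congˡ (xP -ₚ 1ₚ) (+ₚ-cong (*ₚ-congʳ E (≃-sym deriv-2x-2)) (*ₚ-congʳ (deriv E) 2x-2≃)) ⟩
    (xP -ₚ 1ₚ) *ₚ (deriv 2x-2 *ₚ E +ₚ 2x-2 *ₚ deriv E)
      ≈⟨ *ₚ-congˡ (xP -ₚ 1ₚ) (≃-sym (deriv-*ₚ 2x-2 E)) ⟩
    (xP -ₚ 1ₚ) *ₚ deriv (2x-2 *ₚ E) ∎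
    where
    E = expEGF n
    deriv-2x-2 : deriv 2x-2 ≃ constP (+ 2)
    deriv-2x-2 = mk≃ λ { zero → ≡.refl ; (suc j) → ℤP.*-zeroʳ (+ suc (suc j)) }

  expEGF-solves : Solves 2x-2 expEGF
  expEGF-solves = solves ∂t≋𝓛′
    where
    ∂t≋𝓛′ : ∂t expEGF ≋ 𝓛 2x-2 expEGF
    ∂t≋𝓛′ n = begin
      2x-2 *ₚ E
        ≈⟨ solve 3 (λ EE X dE → EE := EE :+ (con (+ 2) :* X) :* ((X :- con (+ 1)) :* dE)
                                     :+ ((con (+ 2) :* X) :* (con (+ 1) :- X)) :* dE)
                 ≃-refl (2x-2 *ₚ E) xP (deriv E) ⟩
      2x-2 *ₚ E +ₚ 2x *ₚ ((xP -ₚ 1ₚ) *ₚ deriv E) +ₚ 2x[1-x] *ₚ deriv E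
        ≈⟨ +ₚ-congʳ (2x[1-x] *ₚ deriv E) (+ₚ-congˡ (2x-2 *ₚ E) (*ₚ-congˡ 2x (≃-sym (t∂t-expEGF n)))) ⟩
      𝓛 2x-2 expEGF n ∎
      where E = expEGF n

  -- The hypothesis says that 𝓛 α annihilates the constant a 0, which is then the whole solution.
  stationary : ∀ {α a} → Solves α a → α *ₚ a 0 +ₚ 2x[1-x] *ₚ deriv (a 0) ≃ 0ₚ → ∀ n → a (suc n) ≃ 0ₚ
  stationary {α} {a} a-solves a₀-stationary zero = begin
    a 1                                                                        ≈⟨ ∂t≋𝓛 a-solves 0 ⟩
    α *ₚ a 0 +ₚ 2x *ₚ (constP (+ 0) *ₚ a 0) +ₚ 2x[1-x] *ₚ deriv (a 0)
      ≈⟨ solve 4 (λ Al A X dA → Al :* A :+ (con (+ 2) :* X) :* (con (+ 0) :* A) :+ ((con (+ 2) :* X) :* (con (+ 1) :- X)) :* dA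
                  := Al :* A :+ ((con (+ 2) :* X) :* (con (+ 1) :- X)) :* dA)
               ≃-refl α (a 0) xP (deriv (a 0)) ⟩
    α *ₚ a 0 +ₚ 2x[1-x] *ₚ deriv (a 0)                                          ≈⟨ a₀-stationary ⟩
    0ₚ ∎
  stationary {α} {a} a-solves a₀-stationary (suc n) = begin
    a (suc (suc n))                                                            ≈⟨ ∂t≋𝓛 a-solves (suc n) ⟩
    α *ₚ a (suc n) +ₚ 2x *ₚ (constP (+ suc n) *ₚ a (suc n)) +ₚ 2x[1-x] *ₚ deriv (a (suc n))
      ≈⟨ +ₚ-cong (+ₚ-cong (*ₚ-congˡ α aₙ≃0) (*ₚ-congˡ 2x (*ₚ-congˡ (constP (+ suc n)) aₙ≃0)))
                 (*ₚ-congˡ 2x[1-x] (≃-trans (deriv-cong aₙ≃0) (≃-trans (deriv-constP (+ 0)) (≃-sym constP-0)))) ⟩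
    α *ₚ constP (+ 0) +ₚ 2x *ₚ (constP (+ suc n) *ₚ constP (+ 0)) +ₚ 2x[1-x] *ₚ constP (+ 0)
      ≈⟨ solve 3 (λ Al X N → Al :* con (+ 0) :+ (con (+ 2) :* X) :* (N :* con (+ 0))
                            :+ ((con (+ 2) :* X) :* (con (+ 1) :- X)) :* con (+ 0) := con (+ 0))
               ≃-refl α xP (constP (+ suc n)) ⟩
    constP (+ 0)                                                               ≈⟨ constP-0 ⟩
    0ₚ ∎
    where
    aₙ≃0 : a (suc n) ≃ constP (+ 0)
    aₙ≃0 = ≃-trans (stationary {α} {a} a-solves a₀-stationary n) (≃-sym constP-0)

  private
    Q² H : EGF
    Q² = qq ⋆ qq
    H  = Q² ⋆ expEGF ⊖ xP ∙ Q²

    H-solves : Solves ((1ₚ +ₚ 1ₚ) +ₚ 2x-2) H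
    H-solves = ⊖-solves (⋆-solves Q²-solves expEGF-solves) (xP∙-solves Q²-solves)
      where Q²-solves = ⋆-solves qq-solves qq-solves

    H₀ : H 0 ≃ 1ₚ -ₚ xP
    H₀ = begin
      (Q² ⋆ expEGF) 0 -ₚ xP *ₚ Q² 0
        ≈⟨ +ₚ-cong (≃-trans (⋆-zero Q² expEGF) (*ₚ-congʳ 1ₚ (⋆-zero qq qq))) (-‿cong (*ₚ-congˡ xP (⋆-zero qq qq))) ⟩
      (1ₚ *ₚ 1ₚ) *ₚ 1ₚ -ₚ xP *ₚ (1ₚ *ₚ 1ₚ)
        ≈⟨ solve 1 (λ X → (con (+ 1) :* con (+ 1)) :* con (+ 1) :- X :* (con (+ 1) :* con (+ 1)) := con (+ 1) :- X)
                 ≃-refl xP ⟩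
      1ₚ -ₚ xP ∎

    H₀-stationary : ((1ₚ +ₚ 1ₚ) +ₚ 2x-2) *ₚ H 0 +ₚ 2x[1-x] *ₚ deriv (H 0) ≃ 0ₚ
    H₀-stationary = begin
      ((1ₚ +ₚ 1ₚ) +ₚ 2x-2) *ₚ H 0 +ₚ 2x[1-x] *ₚ deriv (H 0)
        ≈⟨ +ₚ-cong (*ₚ-cong (+ₚ-congˡ (1ₚ +ₚ 1ₚ) (≃-sym 2x-2≃)) H₀) (*ₚ-congˡ 2x[1-x] deriv-H₀) ⟩
      ((1ₚ +ₚ 1ₚ) +ₚ (2x -ₚ constP (+ 2))) *ₚ (1ₚ -ₚ xP) +ₚ 2x[1-x] *ₚ (constP (+ 0) -ₚ 1ₚ)
        ≈⟨ solve 1 (λ X → ((con (+ 1) :+ con (+ 1)) :+ ((con (+ 2) :* X) :- con (+ 2))) :* (con (+ 1) :- X)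
                          :+ ((con (+ 2) :* X) :* (con (+ 1) :- X)) :* (con (+ 0) :- con (+ 1)) := con (+ 0))
                 ≃-refl xP ⟩
      constP (+ 0) ≈⟨ constP-0 ⟩
      0ₚ ∎
      where
      deriv-H₀ : deriv (H 0) ≃ constP (+ 0) -ₚ 1ₚ
      deriv-H₀ = ≃-trans (deriv-cong H₀) (≃-trans (deriv--ₚ 1ₚ xP)
                   (+ₚ-cong (≃-trans (deriv-constP (+ 1)) (≃-sym constP-0)) (-‿cong deriv-xP)))

  Q²E-xQ²≡1-x : ∀ n → ((qq ⋆ qq) ⋆ expEGF) n -ₚ xP *ₚ (qq ⋆ qq) n ≈ₚ constEGF (1ₚ -ₚ xP) n
  Q²E-xQ²≡1-x zero    = coeffs H₀
  Q²E-xQ²≡1-x (suc n) = coeffs (≃-trans (stationary H-solves H₀-stationary n) (≃-sym constP-0))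

module QCoefficients where

  open import Data.Nat using (zero; suc)
  open import Data.Integer using (+_; _+_; _*_; _-_)
  open import Relation.Binary.PropositionalEquality
  open import Data.Integer.Tactic.RingSolver using (solve-∀)
  open import Defs
  open Polynomial
  open GeneratingFunctionIdentity

  private
    -- 𝓛 1ₚ qq m with 2x(1-x) expanded, so that every summand is a constant times a product with xP.
    qq-suc-expanded : ∀ m → qq (suc m) ≃
      1ₚ *ₚ qq m +ₚ constP (+ 2) *ₚ (xP *ₚ (constP (+ m) *ₚ qq m)) +ₚ constP (+ 2) *ₚ (xP *ₚ deriv (qq m))
      -ₚ constP (+ 2) *ₚ (xP *ₚ (xP *ₚ deriv (qq m)))
    qq-suc-expanded m = ≃-trans (Solves.∂t≋𝓛 qq-solves m) (solve 4 (λ X M Q dQ →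
      con (+ 1) :* Q :+ (con (+ 2) :* X) :* (M :* Q) :+ ((con (+ 2) :* X) :* (con (+ 1) :- X)) :* dQ
      := con (+ 1) :* Q :+ con (+ 2) :* (X :* (M :* Q)) :+ con (+ 2) :* (X :* dQ) :- con (+ 2) :* (X :* (X :* dQ)))
      ≃-refl xP (constP (+ m)) (qq m) (deriv (qq m)))

  qq-suc-coeff-zero : ∀ m → qq (suc m) 0 ≡ qq m 0
  qq-suc-coeff-zero m = begin
    qq (suc m) 0
      ≡⟨ coeffs (qq-suc-expanded m) 0 ⟩
    (1ₚ *ₚ qq m) 0 + (constP (+ 2) *ₚ (xP *ₚ (constP (+ m) *ₚ qq m))) 0 + (constP (+ 2) *ₚ (xP *ₚ deriv (qq m))) 0
      - (constP (+ 2) *ₚ (xP *ₚ (xP *ₚ deriv (qq m)))) 0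
      ≡⟨ cong₂ _-_ (cong₂ _+_ (cong₂ _+_ (constP-*ₚ-coeff (+ 1) (qq m) 0) (twice-x* (constP (+ m) *ₚ qq m)))
                              (twice-x* (deriv (qq m))))
                   (twice-x* (xP *ₚ deriv (qq m))) ⟩
    + 1 * qq m 0 + + 2 * + 0 + + 2 * + 0 - + 2 * + 0
      ≡⟨ simplify (qq m 0) ⟩
    qq m 0 ∎
    where
    open ≡-Reasoning
    twice-x* : ∀ p → (constP (+ 2) *ₚ (xP *ₚ p)) 0 ≡ + 2 * + 0
    twice-x* p = trans (constP-*ₚ-coeff (+ 2) (xP *ₚ p) 0) (cong (+ 2 *_) (xP-*ₚ-coeff-zero p))
    simplify : ∀ a → + 1 * a + + 2 * + 0 + + 2 * + 0 - + 2 * + 0 ≡ a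
    simplify = solve-∀

  qq-suc-coeff-suc : ∀ m i → qq (suc m) (suc i) ≡ (+ 1 + + 2 * + suc i) * qq m (suc i) + + 2 * (+ m - + i) * qq m i
  qq-suc-coeff-suc m i = begin
    qq (suc m) (suc i)
      ≡⟨ coeffs (qq-suc-expanded m) (suc i) ⟩
    (1ₚ *ₚ qq m) (suc i) + (constP (+ 2) *ₚ (xP *ₚ (constP (+ m) *ₚ qq m))) (suc i)
      + (constP (+ 2) *ₚ (xP *ₚ deriv (qq m))) (suc i) - (constP (+ 2) *ₚ (xP *ₚ (xP *ₚ deriv (qq m)))) (suc i)
      ≡⟨ cong₂ _-_ (cong₂ _+_ (cong₂ _+_ (constP-*ₚ-coeff (+ 1) (qq m) (suc i))
                                         (twice-x* (constP (+ m) *ₚ qq m) (constP-*ₚ-coeff (+ m) (qq m) i)))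
                              (twice-x* (deriv (qq m)) refl))
                   (twice-x* (xP *ₚ deriv (qq m)) (xP-*ₚ-deriv-coeff (qq m) i)) ⟩
    + 1 * qq m (suc i) + + 2 * (+ m * qq m i) + + 2 * (+ suc i * qq m (suc i)) - + 2 * (+ i * qq m i)
      ≡⟨ collect (+ suc i) (+ m) (+ i) (qq m (suc i)) (qq m i) ⟩
    (+ 1 + + 2 * + suc i) * qq m (suc i) + + 2 * (+ m - + i) * qq m i ∎
    where
    open ≡-Reasoning
    twice-x* : ∀ p {c} → p i ≡ c → (constP (+ 2) *ₚ (xP *ₚ p)) (suc i) ≡ + 2 * c
    twice-x* p pᵢ≡c = trans (constP-*ₚ-coeff (+ 2) (xP *ₚ p) (suc i)) (cong (+ 2 *_) (trans (xP-*ₚ-coeff-suc p i) pᵢ≡c))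
    collect : ∀ s m i a b → + 1 * a + + 2 * (m * b) + + 2 * (s * a) - + 2 * (i * b) ≡ (+ 1 + + 2 * s) * a + + 2 * (m - i) * b
    collect = solve-∀

module Permutation where

  open import Data.Nat using (ℕ; zero; suc)
  import Data.Nat.Properties as ℕP
  open import Data.Bool using (Bool; true; false; not; _∨_; T)
  open import Data.Bool.Properties using (T?; T-≡)
  open import Data.Bool.ListAction using (and)
  open import Data.Fin as F using (Fin; toℕ; inject₁; fromℕ; lower₁; punchOut)
  import Data.Fin.Properties as FP
  open import Data.Fin.Relation.Unary.Top using (View; view; ‵fromℕ; ‵inj₁; ‵inject₁; view-fromℕ; view-inject₁)
  open import Data.Vec using (Vec; []; _∷_; lookup; tabulate)
  import Data.Vec.Properties as VP
  open import Data.Maybe using (Maybe; just; nothing)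
  import Data.Maybe.Properties as MP
  open import Data.List using (List; []; _∷_; map; concatMap; allFin; cartesianProductWith; _++_)
  open import Data.List.Membership.Propositional using (_∈_)
  open import Data.List.Membership.Propositional.Properties
  open import Data.List.Membership.Propositional.Properties.WithK using (unique∧set⇒bag)
  open import Data.List.Relation.Binary.BagAndSetEquality using (∼bag⇒↭)
  open import Data.List.Relation.Binary.Permutation.Propositional using (_↭_)
  open import Data.List.Relation.Unary.Unique.Propositional using (Unique)
  import Data.List.Relation.Unary.Unique.Propositional.Properties as Unique
  open import Data.List.Relation.Unary.Any using (here; there)
  open import Data.List.Relation.Unary.AllPairs using ([]; _∷_)
  import Data.List.Relation.Unary.All as All
  open All using ([])
  open import Data.Product using (_×_; _,_; proj₂; ∃; ∃₂)
  open import Function using (_∘_; Injective; Equivalence; mk⇔)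
  open import Relation.Binary.PropositionalEquality
  open import Relation.Nullary using (yes; no; contradiction)
  open import Defs

  Perm : ℕ → Set
  Perm n = Vec (Fin n) n

  IsPerm : ∀ {n} → Perm n → Set
  IsPerm π = Injective _≡_ _≡_ (lookup π)

  T⇒≡true : ∀ {b} → T b → b ≡ true
  T⇒≡true = Equivalence.to T-≡

  ≡true⇒T : ∀ {b} → b ≡ true → T b
  ≡true⇒T = Equivalence.from T-≡

  private
    ==ꟳ-sound : ∀ {n} {i j : Fin n} → (i ==ꟳ j) ≡ true → i ≡ j
    ==ꟳ-sound {i = i} {j} eq = FP.toℕ-injective (ℕP.≡ᵇ⇒≡ (toℕ i) (toℕ j) (≡true⇒T eq))

    ==ꟳ-refl : ∀ {n} (i : Fin n) → (i ==ꟳ i) ≡ true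
    ==ꟳ-refl i = T⇒≡true (ℕP.≡⇒≡ᵇ (toℕ i) (toℕ i) refl)

    concatMap-map : ∀ {A B C : Set} (f : A → B → C) xs ys →
                    concatMap (λ a → map (f a) ys) xs ≡ cartesianProductWith f xs ys
    concatMap-map f []       ys = refl
    concatMap-map f (x ∷ xs) ys = cong (map (f x) ys ++_) (concatMap-map f xs ys)

  and-elim : ∀ {xs b} → and xs ≡ true → b ∈ xs → b ≡ true
  and-elim {true ∷ xs}  _  (here refl) = refl
  and-elim {true ∷ xs}  eq (there b∈) = and-elim eq b∈

  and-intro : ∀ xs → (∀ b → b ∈ xs → b ≡ true) → and xs ≡ true
  and-intro []           all-true = refl
  and-intro (true ∷ xs)  all-true = and-intro xs (λ b b∈ → all-true b (there b∈))
  and-intro (false ∷ xs) all-true = all-true false (here refl)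

  private
    module InjectivityTest {n} (π : Perm n) where
      test : Fin n → Fin n → Bool
      test i j = not (lookup π i ==ꟳ lookup π j) ∨ (i ==ꟳ j)

      tests : List Bool
      tests = concatMap (λ i → map (test i) (allFin n)) (allFin n)

      test∈tests : ∀ i j → test i j ∈ tests
      test∈tests i j = subst (test i j ∈_) (sym (concatMap-map test (allFin n) (allFin n)))
                             (∈-cartesianProductWith⁺ test (∈-allFin i) (∈-allFin j))

  isInjective-sound : ∀ {n} (π : Perm n) → isInjective π ≡ true → IsPerm π
  isInjective-sound π all-pass {i} {j} πi≡πj with and-elim all-pass (test∈tests i j)
    where open InjectivityTest π
  ... | pass rewrite πi≡πj | ==ꟳ-refl (lookup π j) = ==ꟳ-sound pass

  isInjective-complete : ∀ {n} (π : Perm n) → IsPerm π → isInjective π ≡ true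
  isInjective-complete {n} π π-inj = and-intro tests passes
    where
    open InjectivityTest π
    pass : ∀ i j → test i j ≡ true
    pass i j with lookup π i ==ꟳ lookup π j in eq
    ... | false = refl
    ... | true rewrite π-inj (==ꟳ-sound eq) | ==ꟳ-refl j = refl
    passes : ∀ b → b ∈ tests → b ≡ true
    passes b b∈ with ∈-cartesianProductWith⁻ test (allFin n) (allFin n)
                       (subst (b ∈_) (concatMap-map test (allFin n) (allFin n)) b∈)
    ... | i , j , _ , _ , refl = pass i j

  ∈-vecsOver : ∀ {A : Set} {xs : List A} {m} (v : Vec A m) → (∀ i → lookup v i ∈ xs) → v ∈ vecsOver xs m
  ∈-vecsOver []      _ = here refl
  ∈-vecsOver {xs = xs} {suc m} (a ∷ v) entries∈ =
    subst ((a ∷ v) ∈_) (sym (concatMap-map _∷_ xs (vecsOver xs m)))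
          (∈-cartesianProductWith⁺ _∷_ (entries∈ F.zero) (∈-vecsOver v (entries∈ ∘ F.suc)))

  vecsOver-unique : ∀ {A : Set} {xs : List A} m → Unique xs → Unique (vecsOver xs m)
  vecsOver-unique zero    _        = [] ∷ []
  vecsOver-unique {xs = xs} (suc m) xs-unique = subst Unique (sym (concatMap-map _∷_ xs (vecsOver xs m)))
    (Unique.cartesianProductWith⁺ _∷_ (λ { refl → refl , refl }) xs-unique (vecsOver-unique m xs-unique))

  ∈-Sym⁺ : ∀ {n} {π : Perm n} → IsPerm π → π ∈ Sym n
  ∈-Sym⁺ {n} {π} π-inj =
    ∈-filter⁺ (T? ∘ isInjective) (∈-vecsOver π (λ i → ∈-allFin _)) (≡true⇒T (isInjective-complete π π-inj))

  ∈-Sym⁻ : ∀ {n} {π : Perm n} → π ∈ Sym n → IsPerm π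
  ∈-Sym⁻ {n} {π} π∈ =
    isInjective-sound π (T⇒≡true (proj₂ (∈-filter⁻ (T? ∘ isInjective) {xs = vecsOver (allFin n) n} π∈)))

  Sym-unique : ∀ n → Unique (Sym n)
  Sym-unique n = Unique.filter⁺ (T? ∘ isInjective) (vecsOver-unique n (Unique.allFin⁺ n))

  private
    insert-entry : ∀ {n} → Perm n → Maybe (Fin n) → {x : Fin (suc n)} → View x → Fin (suc n)
    insert-entry σ nothing  ‵fromℕ       = fromℕ _
    insert-entry σ (just i) ‵fromℕ       = inject₁ (lookup σ i)
    insert-entry σ nothing  (‵inject₁ k) = inject₁ (lookup σ k)
    insert-entry σ (just i) (‵inject₁ k) with k F.≟ i
    ... | yes _ = fromℕ _
    ... | no _  = inject₁ (lookup σ k)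

  -- Inserting n into σ ∈ 𝔖ₙ: as a new fixed point (nothing), or right after i in the cycle of i (just i).
  insert : ∀ {n} → Perm n → Maybe (Fin n) → Perm (suc n)
  insert σ o = tabulate (λ x → insert-entry σ o (view x))

  private
    lookup-insert-inject₁ : ∀ {n} (σ : Perm n) o k → lookup (insert σ o) (inject₁ k) ≡ insert-entry σ o (‵inj₁ (view k))
    lookup-insert-inject₁ σ o k =
      trans (VP.lookup∘tabulate (λ x → insert-entry σ o (view x)) (inject₁ k)) (cong (insert-entry σ o) (view-inject₁ k))

    lookup-insert-fromℕ : ∀ {n} (σ : Perm n) o → lookup (insert σ o) (fromℕ n) ≡ insert-entry σ o ‵fromℕ
    lookup-insert-fromℕ {n} σ o =
      trans (VP.lookup∘tabulate (λ x → insert-entry σ o (view x)) (fromℕ n)) (cong (insert-entry σ o) (view-fromℕ n))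

  insert-fixed-old : ∀ {n} (σ : Perm n) k → lookup (insert σ nothing) (inject₁ k) ≡ inject₁ (lookup σ k)
  insert-fixed-old σ = lookup-insert-inject₁ σ nothing

  insert-fixed-new : ∀ {n} (σ : Perm n) → lookup (insert σ nothing) (fromℕ n) ≡ fromℕ n
  insert-fixed-new σ = lookup-insert-fromℕ σ nothing

  insert-after-new : ∀ {n} (σ : Perm n) i → lookup (insert σ (just i)) (fromℕ n) ≡ inject₁ (lookup σ i)
  insert-after-new σ i = lookup-insert-fromℕ σ (just i)

  insert-after-at : ∀ {n} (σ : Perm n) i → lookup (insert σ (just i)) (inject₁ i) ≡ fromℕ n
  insert-after-at σ i with lookup-insert-inject₁ σ (just i) i
  ... | eq with i F.≟ i
  ...   | yes _   = eq
  ...   | no i≢i = contradiction refl i≢i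

  insert-after-other : ∀ {n} (σ : Perm n) i k → k ≢ i → lookup (insert σ (just i)) (inject₁ k) ≡ inject₁ (lookup σ k)
  insert-after-other σ i k k≢i with lookup-insert-inject₁ σ (just i) k
  ... | eq with k F.≟ i
  ...   | yes k≡i = contradiction k≡i k≢i
  ...   | no _    = eq

  inject₁≢fromℕ : ∀ {n} {k : Fin n} → inject₁ k ≢ fromℕ n
  inject₁≢fromℕ eq = FP.fromℕ≢inject₁ (sym eq)

  insert-isPerm : ∀ {n} (σ : Perm n) o → IsPerm σ → IsPerm (insert σ o)
  insert-isPerm σ o σ-inj {x} {y} eq with view x | view y
  insert-isPerm σ nothing σ-inj eq | ‵inject₁ k | ‵inject₁ k′
    rewrite insert-fixed-old σ k | insert-fixed-old σ k′ = cong inject₁ (σ-inj (FP.inject₁-injective eq))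
  insert-isPerm σ nothing σ-inj eq | ‵inject₁ k | ‵fromℕ
    rewrite insert-fixed-old σ k | insert-fixed-new σ = contradiction eq inject₁≢fromℕ
  insert-isPerm σ nothing σ-inj eq | ‵fromℕ | ‵inject₁ k′
    rewrite insert-fixed-old σ k′ | insert-fixed-new σ = contradiction (sym eq) inject₁≢fromℕ
  insert-isPerm σ nothing σ-inj eq | ‵fromℕ | ‵fromℕ = refl
  insert-isPerm σ (just i) σ-inj eq | ‵inject₁ k | ‵inject₁ k′ with k F.≟ i | k′ F.≟ i
  ... | yes refl | yes refl = refl
  ... | yes refl | no k′≢i rewrite insert-after-at σ k | insert-after-other σ k k′ k′≢i =
    contradiction (sym eq) inject₁≢fromℕ
  ... | no k≢i | yes refl rewrite insert-after-at σ k′ | insert-after-other σ k′ k k≢i =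
    contradiction eq inject₁≢fromℕ
  ... | no k≢i | no k′≢i rewrite insert-after-other σ i k k≢i | insert-after-other σ i k′ k′≢i =
    cong inject₁ (σ-inj (FP.inject₁-injective eq))
  insert-isPerm σ (just i) σ-inj eq | ‵inject₁ k | ‵fromℕ with k F.≟ i
  ... | yes refl rewrite insert-after-at σ k | insert-after-new σ k = contradiction (sym eq) inject₁≢fromℕ
  ... | no k≢i rewrite insert-after-other σ i k k≢i | insert-after-new σ i =
    contradiction (σ-inj (FP.inject₁-injective eq)) k≢i
  insert-isPerm σ (just i) σ-inj eq | ‵fromℕ | ‵inject₁ k with k F.≟ i
  ... | yes refl rewrite insert-after-at σ k | insert-after-new σ k = contradiction eq inject₁≢fromℕ
  ... | no k≢i rewrite insert-after-other σ i k k≢i | insert-after-new σ i =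
    contradiction (σ-inj (FP.inject₁-injective (sym eq))) k≢i
  insert-isPerm σ (just i) σ-inj eq | ‵fromℕ | ‵fromℕ = refl

  vec-ext : ∀ {A : Set} {n} {u v : Vec A n} → (∀ k → lookup u k ≡ lookup v k) → u ≡ v
  vec-ext {u = u} {v} eq = trans (sym (VP.tabulate∘lookup u)) (trans (VP.tabulate-cong eq) (VP.tabulate∘lookup v))

  insert-injective : ∀ {n} {σ σ′ : Perm n} {o o′} → insert σ o ≡ insert σ′ o′ → σ ≡ σ′ × o ≡ o′
  insert-injective {n} {σ} {σ′} {nothing} {nothing} eq =
    vec-ext (λ k → FP.inject₁-injective (trans (sym (insert-fixed-old σ k))
                    (trans (cong (λ π → lookup π (inject₁ k)) eq) (insert-fixed-old σ′ k)))) , refl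
  insert-injective {n} {σ} {σ′} {nothing} {just i′} eq = contradiction
    (trans (sym (insert-after-new σ′ i′)) (trans (cong (λ π → lookup π (fromℕ n)) (sym eq)) (insert-fixed-new σ)))
    inject₁≢fromℕ
  insert-injective {n} {σ} {σ′} {just i} {nothing} eq = contradiction
    (trans (sym (insert-after-new σ i)) (trans (cong (λ π → lookup π (fromℕ n)) eq) (insert-fixed-new σ′)))
    inject₁≢fromℕ
  insert-injective {n} {σ} {σ′} {just i} {just i′} eq with i F.≟ i′
  ... | no i≢i′ = contradiction
    (trans (sym (insert-after-other σ′ i′ i i≢i′)) (trans (cong (λ π → lookup π (inject₁ i)) (sym eq)) (insert-after-at σ i)))
    inject₁≢fromℕ
  ... | yes refl = vec-ext same , refl
    where
    at : ∀ x → lookup (insert σ (just i)) x ≡ lookup (insert σ′ (just i)) x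
    at x = cong (λ π → lookup π x) eq
    same : ∀ k → lookup σ k ≡ lookup σ′ k
    same k with k F.≟ i
    ... | yes refl = FP.inject₁-injective (trans (sym (insert-after-new σ k)) (trans (at (fromℕ n)) (insert-after-new σ′ k)))
    ... | no k≢i   = FP.inject₁-injective (trans (sym (insert-after-other σ i k k≢i))
                                          (trans (at (inject₁ k)) (insert-after-other σ′ i k k≢i)))

  isPerm-surjective : ∀ {n} (π : Perm (suc n)) → IsPerm π → ∀ y → ∃ λ x → lookup π x ≡ y
  isPerm-surjective {n} π π-inj y with FP.any? (λ x → lookup π x F.≟ y)
  ... | yes hit = hit
  ... | no miss with FP.pigeonhole (ℕP.n<1+n n) (λ x → punchOut {i = y} {j = lookup π x} (λ e → miss (x , sym e)))
  ...   | i , j , i<j , eq =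
    contradiction (π-inj (FP.punchOut-injective (λ e → miss (i , sym e)) (λ e → miss (j , sym e)) eq))
                  (FP.<⇒≢ i<j)

  -- Every π ∈ 𝔖ₙ₊₁ arises by insertion: remove n from its cycle and lower the remaining values.
  module _ {n} (π : Perm (suc n)) (π-inj : IsPerm π) where
    private
      restrict : (h : Fin n → Fin (suc n)) → (∀ k → n ≢ toℕ (lookup π (h k))) → Perm n
      restrict h avoids = tabulate (λ k → lower₁ (lookup π (h k)) (avoids k))

      restrict-inject₁ : ∀ h avoids k → inject₁ (lookup (restrict h avoids) k) ≡ lookup π (h k)
      restrict-inject₁ h avoids k =
        trans (cong inject₁ (VP.lookup∘tabulate _ k)) (FP.inject₁-lower₁ (lookup π (h k)) (avoids k))

      restrict-isPerm : ∀ h avoids → Injective _≡_ _≡_ h → IsPerm (restrict h avoids)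
      restrict-isPerm h avoids h-inj eq =
        h-inj (π-inj (trans (sym (restrict-inject₁ h avoids _)) (trans (cong inject₁ eq) (restrict-inject₁ h avoids _))))

      toℕ≡n : ∀ {x} → n ≡ toℕ x → x ≡ fromℕ n
      toℕ≡n eq = FP.toℕ-injective (trans (sym eq) (sym (FP.toℕ-fromℕ n)))

    insert-surjective : ∃₂ λ (σ : Perm n) o → IsPerm σ × insert σ o ≡ π
    insert-surjective with isPerm-surjective π π-inj (fromℕ n)
    ... | p , πp≡n with view p
    ... | ‵fromℕ = σ , nothing , restrict-isPerm inject₁ avoids FP.inject₁-injective , vec-ext agree
      where
      avoids : ∀ k → n ≢ toℕ (lookup π (inject₁ k))
      avoids k eq = inject₁≢fromℕ (π-inj (trans (toℕ≡n eq) (sym πp≡n)))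
      σ = restrict inject₁ avoids
      agree : ∀ x → lookup (insert σ nothing) x ≡ lookup π x
      agree x with view x
      ... | ‵inject₁ k = trans (insert-fixed-old σ k) (restrict-inject₁ inject₁ avoids k)
      ... | ‵fromℕ     = trans (insert-fixed-new σ) (sym πp≡n)
    ... | ‵inject₁ i = σ , just i , restrict-isPerm h avoids h-inj , vec-ext agree
      where
      h : Fin n → Fin (suc n)
      h k with k F.≟ i
      ... | yes _ = fromℕ n
      ... | no _  = inject₁ k
      h-at : h i ≡ fromℕ n
      h-at with i F.≟ i
      ... | yes _   = refl
      ... | no i≢i = contradiction refl i≢i
      h-other : ∀ k → k ≢ i → h k ≡ inject₁ k
      h-other k k≢i with k F.≟ i
      ... | yes k≡i = contradiction k≡i k≢i
      ... | no _    = refl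
      h-inj : Injective _≡_ _≡_ h
      h-inj {k} {k′} eq with k F.≟ i | k′ F.≟ i
      ... | yes refl | yes refl = refl
      ... | yes _    | no _     = contradiction (sym eq) inject₁≢fromℕ
      ... | no _     | yes _    = contradiction eq inject₁≢fromℕ
      ... | no _     | no _     = FP.inject₁-injective eq
      avoids : ∀ k → n ≢ toℕ (lookup π (h k))
      avoids k eq with k F.≟ i
      ... | yes _   = inject₁≢fromℕ (sym (π-inj (trans (toℕ≡n eq) (sym πp≡n))))
      ... | no k≢i = k≢i (FP.inject₁-injective (π-inj (trans (toℕ≡n eq) (sym πp≡n))))
      σ = restrict h avoids
      agree : ∀ x → lookup (insert σ (just i)) x ≡ lookup π x
      agree x with view x
      ... | ‵fromℕ = trans (insert-after-new σ i) (trans (restrict-inject₁ h avoids i) (cong (lookup π) h-at))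
      ... | ‵inject₁ k with k F.≟ i
      ...   | yes refl = trans (insert-after-at σ k) (sym πp≡n)
      ...   | no k≢i   = trans (insert-after-other σ i k k≢i)
                               (trans (restrict-inject₁ h avoids k) (cong (lookup π) (h-other k k≢i)))

  insertionPoints : ∀ n → List (Maybe (Fin n))
  insertionPoints n = nothing ∷ map just (allFin n)

  private
    insertionPoints-unique : ∀ n → Unique (insertionPoints n)
    insertionPoints-unique n = All.tabulate nothing≢ ∷ Unique.map⁺ MP.just-injective (Unique.allFin⁺ n)
      where
      nothing≢ : ∀ {o} → o ∈ map just (allFin n) → nothing ≢ o
      nothing≢ o∈ eq with ∈-map⁻ just o∈
      nothing≢ o∈ refl | _ , _ , ()

    ∈-insertionPoints : ∀ {n} (o : Maybe (Fin n)) → o ∈ insertionPoints n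
    ∈-insertionPoints nothing  = here refl
    ∈-insertionPoints (just i) = there (∈-map⁺ just (∈-allFin i))

  insertions : ∀ n → List (Perm (suc n))
  insertions n = cartesianProductWith insert (Sym n) (insertionPoints n)

  insertions↭Sym : ∀ n → insertions n ↭ Sym (suc n)
  insertions↭Sym n = ∼bag⇒↭ (unique∧set⇒bag
    (Unique.cartesianProductWith⁺ insert insert-injective (Sym-unique n) (insertionPoints-unique n))
    (Sym-unique (suc n)) (mk⇔ to from))
    where
    to : ∀ {π} → π ∈ insertions n → π ∈ Sym (suc n)
    to π∈ with ∈-cartesianProductWith⁻ insert (Sym n) (insertionPoints n) π∈
    ... | σ , o , σ∈ , _ , refl = ∈-Sym⁺ (insert-isPerm σ o (∈-Sym⁻ σ∈))
    from : ∀ {π} → π ∈ Sym (suc n) → π ∈ insertions n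
    from {π} π∈ with insert-surjective π (∈-Sym⁻ π∈)
    ... | σ , o , σ-inj , refl = ∈-cartesianProductWith⁺ insert (∈-Sym⁺ σ-inj) (∈-insertionPoints o)

module ExcedancesAndCycles where

  open import Data.Nat using (ℕ; zero; suc; _+_; _∸_; _<_; _≤_; z≤n; s≤s; _<ᵇ_; _≤ᵇ_)
  import Data.Nat.Properties as ℕP
  open import Data.Nat.Tactic.RingSolver using (solve-∀)
  open import Data.Bool using (Bool; true; false; not)
  open import Data.Fin as F using (Fin; toℕ; inject₁; fromℕ)
  import Data.Fin.Properties as FP
  open import Data.Vec using (lookup)
  open import Data.Maybe using (just; nothing)
  open import Data.List as L using (map; allFin; upTo)
  open import Data.Bool.ListAction using (and)
  open import Data.List.Membership.Propositional using (_∈_)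
  open import Data.List.Membership.Propositional.Properties using (∈-map⁺; ∈-map⁻; ∈-upTo⁺; ∈-upTo⁻)
  open import Data.Product using (_×_; _,_; ∃)
  open import Data.Sum using (_⊎_; inj₁; inj₂)
  open import Function using (_∘_; id; mk⇔)
  open import Data.Bool.Properties using (⇔→≡)
  open import Relation.Binary.PropositionalEquality
  open import Relation.Nullary using (yes; no; contradiction)
  open import Defs
  open Permutation

  boolToℕ : Bool → ℕ
  boolToℕ true  = 1
  boolToℕ false = 0

  countFin : ∀ {n} → (Fin n → Bool) → ℕ
  countFin {zero}  P = 0
  countFin {suc n} P = boolToℕ (P F.zero) + countFin (P ∘ F.suc)

  count-tabulate : ∀ {A : Set} {n} (P : A → Bool) (f : Fin n → A) → count P (L.tabulate f) ≡ countFin (P ∘ f)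
  count-tabulate {n = zero}  P f = refl
  count-tabulate {n = suc n} P f with P (f F.zero)
  ... | true  = cong suc (count-tabulate P (f ∘ F.suc))
  ... | false = count-tabulate P (f ∘ F.suc)

  count-allFin : ∀ {n} (P : Fin n → Bool) → count P (allFin n) ≡ countFin P
  count-allFin P = count-tabulate P id

  countFin-cong : ∀ {n} {P Q : Fin n → Bool} → (∀ i → P i ≡ Q i) → countFin P ≡ countFin Q
  countFin-cong {zero}  _   = refl
  countFin-cong {suc n} P≗Q = cong₂ _+_ (cong boolToℕ (P≗Q F.zero)) (countFin-cong (P≗Q ∘ F.suc))

  countFin-last : ∀ {n} (P : Fin (suc n) → Bool) → countFin P ≡ countFin (P ∘ inject₁) + boolToℕ (P (fromℕ n))
  countFin-last {zero}  P = ℕP.+-comm (boolToℕ (P F.zero)) 0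
  countFin-last {suc n} P = trans (cong (boolToℕ (P F.zero) +_) (countFin-last (P ∘ F.suc)))
                                  (sym (ℕP.+-assoc (boolToℕ (P F.zero)) _ _))

  countFin-update : ∀ {n} (P Q : Fin n → Bool) i → (∀ k → k ≢ i → P k ≡ Q k) →
                    countFin P + boolToℕ (Q i) ≡ countFin Q + boolToℕ (P i)
  countFin-update {suc n} P Q F.zero agree
    rewrite countFin-cong {P = P ∘ F.suc} {Q = Q ∘ F.suc} (λ k → agree (F.suc k) (λ ())) =
    swap (boolToℕ (P F.zero)) (countFin (Q ∘ F.suc)) (boolToℕ (Q F.zero))
    where
    swap : ∀ a b c → a + b + c ≡ c + b + a
    swap = solve-∀
  countFin-update {suc n} P Q (F.suc i) agree rewrite agree F.zero (λ ()) =
    trans (ℕP.+-assoc (boolToℕ (Q F.zero)) (countFin (P ∘ F.suc)) _)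
    (trans (cong (boolToℕ (Q F.zero) +_)
                 (countFin-update (P ∘ F.suc) (Q ∘ F.suc) i (λ k k≢i → agree (F.suc k) (k≢i ∘ FP.suc-injective))))
           (sym (ℕP.+-assoc (boolToℕ (Q F.zero)) (countFin (Q ∘ F.suc)) _)))

  countFin-complement : ∀ {n} (P : Fin n → Bool) → countFin P + countFin (not ∘ P) ≡ n
  countFin-complement {zero}  P = refl
  countFin-complement {suc n} P with P F.zero
  ... | true  = cong suc (countFin-complement (P ∘ F.suc))
  ... | false = trans (ℕP.+-suc (countFin (P ∘ F.suc)) _) (cong suc (countFin-complement (P ∘ F.suc)))

  isExc : ∀ {n} → Perm n → Fin n → Bool
  isExc π i = toℕ i <ᵇ toℕ (lookup π i)

  exc≡countFin : ∀ {n} (π : Perm n) → exc π ≡ countFin (isExc π)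
  exc≡countFin π = count-allFin (isExc π)

  private
    <ᵇ-false : ∀ {m n} → n ≤ m → (m <ᵇ n) ≡ false
    <ᵇ-false {m} {n} n≤m with m <ᵇ n in eq
    ... | false = refl
    ... | true  = contradiction n≤m (ℕP.<⇒≱ (ℕP.<ᵇ⇒< m n (≡true⇒T eq)))

  exc-insert-fixed : ∀ {n} (σ : Perm n) → exc (insert σ nothing) ≡ exc σ
  exc-insert-fixed {n} σ = begin
    exc (insert σ nothing)                                                       ≡⟨ exc≡countFin (insert σ nothing) ⟩
    countFin (isExc π)                                                           ≡⟨ countFin-last (isExc π) ⟩
    countFin (isExc π ∘ inject₁) + boolToℕ (isExc π (fromℕ n))
      ≡⟨ cong₂ _+_ (countFin-cong old) (cong boolToℕ new) ⟩
    countFin (isExc σ) + 0                                                       ≡⟨ ℕP.+-identityʳ _ ⟩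
    countFin (isExc σ)                                                           ≡⟨ exc≡countFin σ ⟨
    exc σ ∎
    where
    open ≡-Reasoning
    π = insert σ nothing
    old : ∀ k → isExc π (inject₁ k) ≡ isExc σ k
    old k rewrite insert-fixed-old σ k | FP.toℕ-inject₁ k | FP.toℕ-inject₁ (lookup σ k) = refl
    new : isExc π (fromℕ n) ≡ false
    new rewrite insert-fixed-new σ = <ᵇ-false {toℕ (fromℕ n)} ℕP.≤-refl

  -- i → n is an excedance and n → σ(i) is not; only i's own status changes, from isExc σ i to true.
  exc-insert-after : ∀ {n} (σ : Perm n) i → exc (insert σ (just i)) + boolToℕ (isExc σ i) ≡ exc σ + 1
  exc-insert-after {n} σ i = begin
    exc π + boolToℕ (isExc σ i)
      ≡⟨ cong (_+ boolToℕ (isExc σ i)) (trans (exc≡countFin π) (countFin-last (isExc π))) ⟩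
    countFin old + boolToℕ (isExc π (fromℕ n)) + boolToℕ (isExc σ i)
      ≡⟨ cong (λ b → countFin old + boolToℕ b + boolToℕ (isExc σ i)) new ⟩
    countFin old + 0 + boolToℕ (isExc σ i)
      ≡⟨ cong (_+ boolToℕ (isExc σ i)) (ℕP.+-identityʳ _) ⟩
    countFin old + boolToℕ (isExc σ i)
      ≡⟨ countFin-update (isExc σ) old i unchanged ⟨
    countFin (isExc σ) + boolToℕ (old i)
      ≡⟨ cong₂ _+_ (sym (exc≡countFin σ)) (cong boolToℕ at-i) ⟩
    exc σ + 1 ∎
    where
    open ≡-Reasoning
    π = insert σ (just i)
    old = isExc π ∘ inject₁
    unchanged : ∀ k → k ≢ i → isExc σ k ≡ old k
    unchanged k k≢i rewrite insert-after-other σ i k k≢i | FP.toℕ-inject₁ k | FP.toℕ-inject₁ (lookup σ k) = refl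
    at-i : old i ≡ true
    at-i rewrite insert-after-at σ i | FP.toℕ-inject₁ i | FP.toℕ-fromℕ n = T⇒≡true (ℕP.<⇒<ᵇ (FP.toℕ<n i))
    new : isExc π (fromℕ n) ≡ false
    new rewrite insert-after-new σ i | FP.toℕ-fromℕ n | FP.toℕ-inject₁ (lookup σ i) =
      <ᵇ-false (ℕP.<⇒≤ (FP.toℕ<n (lookup σ i)))

  IsCycleMin : ∀ {n} → Perm n → Fin n → Set
  IsCycleMin π a = ∀ k → toℕ a ≤ toℕ (iter π k a)

  iter-+ : ∀ {n} (π : Perm n) d t a → iter π (d + t) a ≡ iter π d (iter π t a)
  iter-+ π zero    t a = refl
  iter-+ π (suc d) t a = cong (lookup π) (iter-+ π d t a)

  iter-injective : ∀ {n} {π : Perm n} → IsPerm π → ∀ t {b c} → iter π t b ≡ iter π t c → b ≡ c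
  iter-injective π-inj zero    eq = eq
  iter-injective π-inj (suc t) eq = iter-injective π-inj t (π-inj eq)

  -- Pigeonhole on a, π a, …, πⁿ a gives a return time d ≤ n.
  orbit-period : ∀ {n} {π : Perm n} → IsPerm π → ∀ a → ∃ λ d → 0 < d × d ≤ n × iter π d a ≡ a
  orbit-period {n} {π} π-inj a with FP.pigeonhole (ℕP.n<1+n n) (λ t → iter π (toℕ t) a)
  ... | s , t , s<t , eq = toℕ t ∸ toℕ s , ℕP.m<n⇒0<n∸m s<t , d≤n , returns
    where
    d≤n : toℕ t ∸ toℕ s ≤ n
    d≤n = ℕP.≤-trans (ℕP.m∸n≤m (toℕ t) (toℕ s)) (ℕP.≤-pred (FP.toℕ<n t))
    returns : iter π (toℕ t ∸ toℕ s) a ≡ a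
    returns = iter-injective π-inj (toℕ s)
      (trans (sym (iter-+ π (toℕ s) (toℕ t ∸ toℕ s) a))
      (trans (cong (λ m → iter π m a) (ℕP.m+[n∸m]≡n (ℕP.<⇒≤ s<t))) (sym eq)))

  orbit-bounded : ∀ {n} {π : Perm n} → IsPerm π → ∀ a k → ∃ λ k′ → k′ < n × iter π k a ≡ iter π k′ a
  orbit-bounded {n} {π} π-inj a k with orbit-period π-inj a
  ... | d , 0<d , d≤n , period with reduce k
    where
    reduce : ∀ k → ∃ λ k′ → k′ < d × iter π k a ≡ iter π k′ a
    reduce zero    = 0 , 0<d , refl
    reduce (suc k) with reduce k
    ... | k′ , k′<d , eq with suc k′ ℕP.<? d
    ...   | yes k′+1<d = suc k′ , k′+1<d , cong (lookup π) eq
    ...   | no  k′+1≮d = 0 , 0<d , trans (cong (lookup π) eq)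
                                      (trans (cong (λ m → iter π m a) (ℕP.≤-antisym k′<d (ℕP.≮⇒≥ k′+1≮d))) period)
  ... | k′ , k′<d , eq = k′ , ℕP.<-≤-trans k′<d d≤n , eq

  private
    and-upTo-elim : ∀ (f : ℕ → Bool) m → and (map f (upTo m)) ≡ true → ∀ k → k < m → f k ≡ true
    and-upTo-elim f m all-true k k<m = and-elim all-true (∈-map⁺ f (∈-upTo⁺ k<m))

    and-upTo-intro : ∀ (f : ℕ → Bool) m → (∀ k → k < m → f k ≡ true) → and (map f (upTo m)) ≡ true
    and-upTo-intro f m all-true = and-intro _ λ b b∈ → case (∈-map⁻ f b∈)
      where
      case : ∀ {b} → ∃ (λ k → k ∈ upTo m × b ≡ f k) → b ≡ true
      case (k , k∈ , refl) = all-true k (∈-upTo⁻ k∈)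

  isCycleMin-complete : ∀ {n} {π : Perm n} {a} → IsCycleMin π a → isCycleMin π a ≡ true
  isCycleMin-complete {n} min = and-upTo-intro _ n (λ k _ → ≤⇒≤ᵇ≡true (min k))
    where
    ≤⇒≤ᵇ≡true : ∀ {m n} → m ≤ n → (m ≤ᵇ n) ≡ true
    ≤⇒≤ᵇ≡true m≤n = T⇒≡true (ℕP.≤⇒≤ᵇ m≤n)

  -- The test in isCycleMin only inspects πᵏ a for k < n, which already covers the whole orbit.
  isCycleMin-sound : ∀ {n} {π : Perm n} → IsPerm π → ∀ {a} → isCycleMin π a ≡ true → IsCycleMin π a
  isCycleMin-sound {n} {π} π-inj {a} passes k with orbit-bounded π-inj a k
  ... | k′ , k′<n , eq = subst (λ b → toℕ a ≤ toℕ b) (sym eq)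
                               (ℕP.≤ᵇ⇒≤ _ _ (≡true⇒T (and-upTo-elim _ n passes k′ k′<n)))

  private
    isCycleMin-≡ : ∀ {m n} {π : Perm m} {π′ : Perm n} {a a′} → IsPerm π → IsPerm π′ →
                   (IsCycleMin π a → IsCycleMin π′ a′) → (IsCycleMin π′ a′ → IsCycleMin π a) →
                   isCycleMin π a ≡ isCycleMin π′ a′
    isCycleMin-≡ π-inj π′-inj to from = ⇔→≡ {z = true} (mk⇔
      (isCycleMin-complete ∘ to ∘ isCycleMin-sound π-inj)
      (isCycleMin-complete ∘ from ∘ isCycleMin-sound π′-inj))

  iter-insert-fixed : ∀ {n} (σ : Perm n) a k → iter (insert σ nothing) k (inject₁ a) ≡ inject₁ (iter σ k a)
  iter-insert-fixed σ a zero    = refl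
  iter-insert-fixed σ a (suc k) =
    trans (cong (lookup (insert σ nothing)) (iter-insert-fixed σ a k)) (insert-fixed-old σ (iter σ k a))

  -- The orbit of an old point under insert σ (just i) is its σ-orbit, with n visited right after i.
  iter-insert-after : ∀ {n} (σ : Perm n) i a k → ∃ λ m →
    iter (insert σ (just i)) k (inject₁ a) ≡ inject₁ (iter σ m a) ⊎
    (iter (insert σ (just i)) k (inject₁ a) ≡ fromℕ n × iter σ m a ≡ i)
  iter-insert-after σ i a zero = 0 , inj₁ refl
  iter-insert-after σ i a (suc k) with iter-insert-after σ i a k
  ... | m , inj₂ (at-new , σᵐa≡i) =
    suc m , inj₁ (trans (cong (lookup π) at-new)
                 (trans (insert-after-new σ i) (cong (λ b → inject₁ (lookup σ b)) (sym σᵐa≡i))))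
    where π = insert σ (just i)
  ... | m , inj₁ at-old with iter σ m a F.≟ i
  ...   | yes σᵐa≡i = m , inj₂ (trans (cong (lookup π) at-old)
                                  (trans (cong (λ b → lookup π (inject₁ b)) σᵐa≡i) (insert-after-at σ i)) , σᵐa≡i)
    where π = insert σ (just i)
  ...   | no σᵐa≢i = suc m , inj₁ (trans (cong (lookup π) at-old) (insert-after-other σ i _ σᵐa≢i))
    where π = insert σ (just i)

  iter-insert-after-reaches : ∀ {n} (σ : Perm n) i a m → ∃ λ k →
    iter (insert σ (just i)) k (inject₁ a) ≡ inject₁ (iter σ m a)
  iter-insert-after-reaches σ i a zero = 0 , refl
  iter-insert-after-reaches σ i a (suc m) with iter-insert-after-reaches σ i a m
  ... | k , eq with iter σ m a F.≟ i
  ...   | no σᵐa≢i  = suc k , trans (cong (lookup π) eq) (insert-after-other σ i _ σᵐa≢i)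
    where π = insert σ (just i)
  ...   | yes σᵐa≡i = suc (suc k) , trans (cong (lookup π ∘ lookup π) eq)
            (trans (cong (λ b → lookup π (lookup π (inject₁ b))) σᵐa≡i)
            (trans (cong (lookup π) (insert-after-at σ i))
            (trans (insert-after-new σ i) (cong (λ b → inject₁ (lookup σ b)) (sym σᵐa≡i)))))
    where π = insert σ (just i)

  isCycleMin-insert-old : ∀ {n} (σ : Perm n) o a → IsPerm σ → isCycleMin (insert σ o) (inject₁ a) ≡ isCycleMin σ a
  isCycleMin-insert-old {n} σ nothing a σ-inj = isCycleMin-≡ (insert-isPerm σ nothing σ-inj) σ-inj
    (λ min m → ≤-inject₁⁻ (subst (λ b → toℕ (inject₁ a) ≤ toℕ b) (iter-insert-fixed σ a m) (min m)))
    (λ min k → subst (λ b → toℕ (inject₁ a) ≤ toℕ b) (sym (iter-insert-fixed σ a k)) (≤-inject₁ (min k)))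
    where
    ≤-inject₁⁻ : ∀ {b} → toℕ (inject₁ a) ≤ toℕ (inject₁ b) → toℕ a ≤ toℕ b
    ≤-inject₁⁻ {b} le rewrite FP.toℕ-inject₁ a | FP.toℕ-inject₁ b = le
    ≤-inject₁ : ∀ {b} → toℕ a ≤ toℕ b → toℕ (inject₁ a) ≤ toℕ (inject₁ b)
    ≤-inject₁ {b} le rewrite FP.toℕ-inject₁ a | FP.toℕ-inject₁ b = le
  isCycleMin-insert-old {n} σ (just i) a σ-inj = isCycleMin-≡ (insert-isPerm σ (just i) σ-inj) σ-inj
    (λ min m → let k , eq = iter-insert-after-reaches σ i a m in
               ≤-inject₁⁻ (subst (λ b → toℕ (inject₁ a) ≤ toℕ b) eq (min k)))
    from
    where
    ≤-inject₁⁻ : ∀ {b} → toℕ (inject₁ a) ≤ toℕ (inject₁ b) → toℕ a ≤ toℕ b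
    ≤-inject₁⁻ {b} le rewrite FP.toℕ-inject₁ a | FP.toℕ-inject₁ b = le
    from : IsCycleMin σ a → IsCycleMin (insert σ (just i)) (inject₁ a)
    from min k with iter-insert-after σ i a k
    ... | m , inj₁ eq       = subst (λ b → toℕ (inject₁ a) ≤ toℕ b) (sym eq) le
      where le : toℕ (inject₁ a) ≤ toℕ (inject₁ (iter σ m a))
            le rewrite FP.toℕ-inject₁ a | FP.toℕ-inject₁ (iter σ m a) = min m
    ... | m , inj₂ (eq , _) = subst (λ b → toℕ (inject₁ a) ≤ toℕ b) (sym eq) le
      where le : toℕ (inject₁ a) ≤ toℕ (fromℕ n)
            le rewrite FP.toℕ-inject₁ a | FP.toℕ-fromℕ n = ℕP.<⇒≤ (FP.toℕ<n a)

  isCycleMin-insert-fixed-new : ∀ {n} (σ : Perm n) → isCycleMin (insert σ nothing) (fromℕ n) ≡ true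
  isCycleMin-insert-fixed-new {n} σ = isCycleMin-complete λ k → ℕP.≤-reflexive (cong toℕ (sym (stays k)))
    where
    stays : ∀ k → iter (insert σ nothing) k (fromℕ n) ≡ fromℕ n
    stays zero    = refl
    stays (suc k) = trans (cong (lookup (insert σ nothing)) (stays k)) (insert-fixed-new σ)

  isCycleMin-insert-after-new : ∀ {n} (σ : Perm n) i → isCycleMin (insert σ (just i)) (fromℕ n) ≡ false
  isCycleMin-insert-after-new {suc n} σ i with isCycleMin π (fromℕ (suc n)) in passes
    where π = insert σ (just i)
  ... | false = refl
  ... | true  = contradiction (ℕP.≤ᵇ⇒≤ _ _ (≡true⇒T (and-upTo-elim test (suc (suc n)) passes 1 (s≤s (s≤s z≤n)))))
                             (ℕP.<⇒≱ image<n)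
    where
    π = insert σ (just i)
    test : ℕ → Bool
    test k = toℕ (fromℕ (suc n)) ≤ᵇ toℕ (iter π k (fromℕ (suc n)))
    image<n : toℕ (iter π 1 (fromℕ (suc n))) < toℕ (fromℕ (suc n))
    image<n rewrite insert-after-new σ i | FP.toℕ-fromℕ (suc n) | FP.toℕ-inject₁ (lookup σ i) = FP.toℕ<n (lookup σ i)

  cyc≡countFin : ∀ {n} (π : Perm n) → cyc π ≡ countFin (isCycleMin π)
  cyc≡countFin π = count-allFin (isCycleMin π)

  cyc-insert-fixed : ∀ {n} (σ : Perm n) → IsPerm σ → cyc (insert σ nothing) ≡ cyc σ + 1
  cyc-insert-fixed σ σ-inj =
    trans (cyc≡countFin (insert σ nothing)) (trans (countFin-last (isCycleMin (insert σ nothing)))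
    (cong₂ _+_ (trans (countFin-cong (λ a → isCycleMin-insert-old σ nothing a σ-inj)) (sym (cyc≡countFin σ)))
               (cong boolToℕ (isCycleMin-insert-fixed-new σ))))

  cyc-insert-after : ∀ {n} (σ : Perm n) i → IsPerm σ → cyc (insert σ (just i)) ≡ cyc σ
  cyc-insert-after σ i σ-inj =
    trans (cyc≡countFin (insert σ (just i))) (trans (countFin-last (isCycleMin (insert σ (just i))))
    (trans (cong₂ _+_ (trans (countFin-cong (λ a → isCycleMin-insert-old σ (just i) a σ-inj)) (sym (cyc≡countFin σ)))
                      (cong boolToℕ (isCycleMin-insert-after-new σ i)))
           (ℕP.+-identityʳ _)))

module IntegerCast where

  open import Data.Nat using (ℕ)
  open import Data.Integer as ℤ using (ℤ; +_)
  import Data.Integer.Properties as ℤP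
  open import Data.Rational as ℚ using (ℚ; _/_)
  import Data.Rational.Properties as ℚP
  import Data.Rational.Unnormalised as ℚᵘ
  import Data.Rational.Unnormalised.Properties as ℚᵘP
  open import Relation.Binary.PropositionalEquality
  open import Data.Integer.Tactic.RingSolver using (solve-∀)

  ℤ→ℚ : ℤ → ℚ
  ℤ→ℚ z = z / 1

  ℕ→ℚ : ℕ → ℚ
  ℕ→ℚ n = ℤ→ℚ (+ n)

  private
    toℚᵘ-ℤ→ℚ : ∀ z → ℚ.toℚᵘ (ℤ→ℚ z) ℚᵘ.≃ ℚᵘ.mkℚᵘ z 0
    toℚᵘ-ℤ→ℚ z = ℚP.toℚᵘ-fromℚᵘ (ℚᵘ.mkℚᵘ z 0)

  -- Both sides are compared after mapping to unnormalised rationals, where z / 1 is literally mkℚᵘ z 0.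
  ℤ→ℚ-+ : ∀ a b → ℤ→ℚ (a ℤ.+ b) ≡ ℤ→ℚ a ℚ.+ ℤ→ℚ b
  ℤ→ℚ-+ a b = ℚP.toℚᵘ-injective (ℚᵘP.≃-trans (toℚᵘ-ℤ→ℚ (a ℤ.+ b)) (ℚᵘP.≃-sym
    (ℚᵘP.≃-trans (ℚP.toℚᵘ-homo-+ (ℤ→ℚ a) (ℤ→ℚ b))
    (ℚᵘP.≃-trans (ℚᵘP.+-cong (toℚᵘ-ℤ→ℚ a) (toℚᵘ-ℤ→ℚ b)) (ℚᵘ.*≡* (cross a b))))))
    where
    cross : ∀ a b → (a ℤ.* + 1 ℤ.+ b ℤ.* + 1) ℤ.* + 1 ≡ (a ℤ.+ b) ℤ.* (+ 1 ℤ.* + 1)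
    cross = solve-∀

  ℤ→ℚ-* : ∀ a b → ℤ→ℚ (a ℤ.* b) ≡ ℤ→ℚ a ℚ.* ℤ→ℚ b
  ℤ→ℚ-* a b = ℚP.toℚᵘ-injective (ℚᵘP.≃-trans (toℚᵘ-ℤ→ℚ (a ℤ.* b)) (ℚᵘP.≃-sym
    (ℚᵘP.≃-trans (ℚP.toℚᵘ-homo-* (ℤ→ℚ a) (ℤ→ℚ b))
    (ℚᵘP.≃-trans (ℚᵘP.*-cong (toℚᵘ-ℤ→ℚ a) (toℚᵘ-ℤ→ℚ b)) (ℚᵘ.*≡* (cross a b))))))
    where
    cross : ∀ a b → (a ℤ.* b) ℤ.* + 1 ≡ (a ℤ.* b) ℤ.* (+ 1 ℤ.* + 1)
    cross = solve-∀

  ℤ→ℚ-neg : ∀ a → ℤ→ℚ (ℤ.- a) ≡ ℚ.- ℤ→ℚ a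
  ℤ→ℚ-neg a = ℚP.toℚᵘ-injective (ℚᵘP.≃-trans (toℚᵘ-ℤ→ℚ (ℤ.- a)) (ℚᵘP.≃-sym
    (ℚᵘP.≃-trans (ℚP.toℚᵘ-homo‿- (ℤ→ℚ a)) (ℚᵘP.≃-trans (ℚᵘP.-‿cong (toℚᵘ-ℤ→ℚ a)) (ℚᵘ.*≡* refl)))))

  ℤ→ℚ-- : ∀ a b → ℤ→ℚ (a ℤ.- b) ≡ ℤ→ℚ a ℚ.- ℤ→ℚ b
  ℤ→ℚ-- a b = trans (ℤ→ℚ-+ a (ℤ.- b)) (cong (ℤ→ℚ a ℚ.+_) (ℤ→ℚ-neg b))

  ℕ→ℚ-+ : ∀ m n → ℕ→ℚ (m Data.Nat.+ n) ≡ ℕ→ℚ m ℚ.+ ℕ→ℚ n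
  ℕ→ℚ-+ m n = trans (cong ℤ→ℚ (ℤP.pos-+ m n)) (ℤ→ℚ-+ (+ m) (+ n))

module EulerianCoefficients where

  open import Data.Nat as ℕ using (ℕ; zero; suc; _≡ᵇ_)
  import Data.Nat.Properties as ℕP
  open import Data.Bool using (Bool; true; false; not; if_then_else_)
  open import Data.Fin as F using (Fin)
  open import Data.Maybe using (just; nothing)
  open import Data.List as L using (List; []; _∷_; map; allFin; filterᵇ; cartesianProductWith; _++_)
  open import Data.List.Membership.Propositional using (_∈_)
  open import Data.List.Relation.Unary.Any using (here; there)
  open import Data.List.Relation.Binary.Permutation.Propositional as ↭ using (_↭_)
  open import Data.Rational using (ℚ; 0ℚ; 1ℚ; _*_; _+_; _-_)
  import Data.Rational.Properties as ℚP
  open import Data.Rational.Solver using (module +-*-Solver)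
  open +-*-Solver using (solve; _:=_; _:+_; _:*_; _:-_; con)
  open import Function using (_∘_; id)
  open import Relation.Binary.PropositionalEquality
  open import Defs
  open Permutation
  open ExcedancesAndCycles
  open IntegerCast

  ∑ℚ : ∀ {A : Set} → (A → ℚ) → List A → ℚ
  ∑ℚ f xs = sumℚ (map f xs)

  ∑ℚ-filterᵇ : ∀ {A : Set} (f : A → ℚ) (p : A → Bool) xs →
               ∑ℚ f (filterᵇ p xs) ≡ ∑ℚ (λ x → if p x then f x else 0ℚ) xs
  ∑ℚ-filterᵇ f p []       = refl
  ∑ℚ-filterᵇ f p (x ∷ xs) with p x
  ... | true  = cong (f x +_) (∑ℚ-filterᵇ f p xs)
  ... | false = trans (∑ℚ-filterᵇ f p xs) (sym (ℚP.+-identityˡ _))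

  ∑ℚ-↭ : ∀ {A : Set} (f : A → ℚ) {xs ys} → xs ↭ ys → ∑ℚ f xs ≡ ∑ℚ f ys
  ∑ℚ-↭ f ↭.refl          = refl
  ∑ℚ-↭ f (↭.prep x p)    = cong (f x +_) (∑ℚ-↭ f p)
  ∑ℚ-↭ f (↭.swap x y p)  = trans (sym (ℚP.+-assoc (f x) (f y) _))
    (trans (cong₂ _+_ (ℚP.+-comm (f x) (f y)) (∑ℚ-↭ f p)) (ℚP.+-assoc (f y) (f x) _))
  ∑ℚ-↭ f (↭.trans p q)   = trans (∑ℚ-↭ f p) (∑ℚ-↭ f q)

  ∑ℚ-++ : ∀ {A : Set} (f : A → ℚ) xs ys → ∑ℚ f (xs ++ ys) ≡ ∑ℚ f xs + ∑ℚ f ys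
  ∑ℚ-++ f []       ys = sym (ℚP.+-identityˡ _)
  ∑ℚ-++ f (x ∷ xs) ys = trans (cong (f x +_) (∑ℚ-++ f xs ys)) (sym (ℚP.+-assoc (f x) _ _))

  ∑ℚ-map : ∀ {A B : Set} (f : B → ℚ) (g : A → B) xs → ∑ℚ f (map g xs) ≡ ∑ℚ (f ∘ g) xs
  ∑ℚ-map f g []       = refl
  ∑ℚ-map f g (x ∷ xs) = cong (f (g x) +_) (∑ℚ-map f g xs)

  ∑ℚ-cartesianProductWith : ∀ {A B C : Set} (f : C → ℚ) (g : A → B → C) xs ys →
    ∑ℚ f (cartesianProductWith g xs ys) ≡ ∑ℚ (λ x → ∑ℚ (f ∘ g x) ys) xs
  ∑ℚ-cartesianProductWith f g []       ys = refl
  ∑ℚ-cartesianProductWith f g (x ∷ xs) ys =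
    trans (∑ℚ-++ f (map (g x) ys) _) (cong₂ _+_ (∑ℚ-map f (g x) ys) (∑ℚ-cartesianProductWith f g xs ys))

  ∑ℚ-cong-∈ : ∀ {A : Set} {f g : A → ℚ} xs → (∀ x → x ∈ xs → f x ≡ g x) → ∑ℚ f xs ≡ ∑ℚ g xs
  ∑ℚ-cong-∈ []       _   = refl
  ∑ℚ-cong-∈ (x ∷ xs) f≗g = cong₂ _+_ (f≗g x (here refl)) (∑ℚ-cong-∈ xs (λ z z∈ → f≗g z (there z∈)))

  ∑ℚ-affine : ∀ {A : Set} (a : ℚ) (f g : A → ℚ) xs → ∑ℚ (λ x → a * f x + g x) xs ≡ a * ∑ℚ f xs + ∑ℚ g xs
  ∑ℚ-affine a f g []       = sym (trans (ℚP.+-identityʳ (a * 0ℚ)) (ℚP.*-zeroʳ a))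
  ∑ℚ-affine a f g (x ∷ xs) = trans (cong ((a * f x + g x) +_) (∑ℚ-affine a f g xs))
    (solve 5 (λ a fx gx F G → (a :* fx :+ gx) :+ (a :* F :+ G) := a :* (fx :+ F) :+ (gx :+ G))
           refl a (f x) (g x) (∑ℚ f xs) (∑ℚ g xs))

  ∑ℚ-distribˡ : ∀ {A : Set} (a : ℚ) (f : A → ℚ) xs → ∑ℚ (λ x → a * f x) xs ≡ a * ∑ℚ f xs
  ∑ℚ-distribˡ a f []       = sym (ℚP.*-zeroʳ a)
  ∑ℚ-distribˡ a f (x ∷ xs) = trans (cong ((a * f x) +_) (∑ℚ-distribˡ a f xs)) (sym (ℚP.*-distribˡ-+ a (f x) _))

  ∑ℚ-zero : ∀ {A : Set} (xs : List A) → ∑ℚ (λ _ → 0ℚ) xs ≡ 0ℚ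
  ∑ℚ-zero []       = refl
  ∑ℚ-zero (x ∷ xs) = trans (ℚP.+-identityˡ _) (∑ℚ-zero xs)

  ∑Fin : ∀ {n} → (Fin n → ℚ) → ℚ
  ∑Fin {zero}  g = 0ℚ
  ∑Fin {suc n} g = g F.zero + ∑Fin (g ∘ F.suc)

  ∑Fin-cong : ∀ {n} {f g : Fin n → ℚ} → (∀ i → f i ≡ g i) → ∑Fin f ≡ ∑Fin g
  ∑Fin-cong {zero}  _   = refl
  ∑Fin-cong {suc n} f≗g = cong₂ _+_ (f≗g F.zero) (∑Fin-cong (f≗g ∘ F.suc))

  ∑ℚ-tabulate : ∀ {A : Set} {n} (f : A → ℚ) (h : Fin n → A) → ∑ℚ f (L.tabulate h) ≡ ∑Fin (f ∘ h)
  ∑ℚ-tabulate {n = zero}  f h = refl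
  ∑ℚ-tabulate {n = suc n} f h = cong (f (h F.zero) +_) (∑ℚ-tabulate f (h ∘ F.suc))

  ∑ℚ-allFin : ∀ {n} (g : Fin n → ℚ) → ∑ℚ g (allFin n) ≡ ∑Fin g
  ∑ℚ-allFin g = ∑ℚ-tabulate g id

  ∑Fin-if : ∀ {n} (P : Fin n → Bool) A B →
            ∑Fin (λ i → if P i then A else B) ≡ ℕ→ℚ (countFin P) * A + ℕ→ℚ (countFin (not ∘ P)) * B
  ∑Fin-if {zero}  P A B = solve 2 (λ A B → con 0ℚ := con 0ℚ :* A :+ con 0ℚ :* B) refl A B
  ∑Fin-if {suc n} P A B with P F.zero
  ... | true  = trans (cong (A +_) (∑Fin-if (P ∘ F.suc) A B))
    (trans (solve 4 (λ A B a b → A :+ (a :* A :+ b :* B) := (con 1ℚ :+ a) :* A :+ b :* B)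
                    refl A B (ℕ→ℚ (countFin (P ∘ F.suc))) (ℕ→ℚ (countFin (not ∘ P ∘ F.suc))))
           (cong (λ c → c * A + ℕ→ℚ (countFin (not ∘ P ∘ F.suc)) * B) (sym (ℕ→ℚ-+ 1 (countFin (P ∘ F.suc))))))
  ... | false = trans (cong (B +_) (∑Fin-if (P ∘ F.suc) A B))
    (trans (solve 4 (λ A B a b → B :+ (a :* A :+ b :* B) := a :* A :+ (con 1ℚ :+ b) :* B)
                    refl A B (ℕ→ℚ (countFin (P ∘ F.suc))) (ℕ→ℚ (countFin (not ∘ P ∘ F.suc))))
           (cong (λ c → ℕ→ℚ (countFin (P ∘ F.suc)) * A + c * B) (sym (ℕ→ℚ-+ 1 (countFin (not ∘ P ∘ F.suc))))))

  ⟦_≟_⟧_ : ℕ → ℕ → ℚ → ℚ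
  ⟦ e ≟ j ⟧ v = if e ≡ᵇ j then v else 0ℚ

  private
    ⟦≟⟧-coeff : ∀ (f : ℕ → ℚ) e j v → f e * ⟦ e ≟ j ⟧ v ≡ f j * ⟦ e ≟ j ⟧ v
    ⟦≟⟧-coeff f e j v with e ≡ᵇ j in e≡ᵇj
    ... | true  = cong (λ m → f m * v) (ℕP.≡ᵇ⇒≡ e j (≡true⇒T e≡ᵇj))
    ... | false = trans (ℚP.*-zeroʳ (f e)) (sym (ℚP.*-zeroʳ (f j)))

    ⟦≟⟧-scale : ∀ c e j v → ⟦ e ≟ j ⟧ (c * v) ≡ c * ⟦ e ≟ j ⟧ v
    ⟦≟⟧-scale c e j v with e ≡ᵇ j
    ... | true  = refl
    ... | false = sym (ℚP.*-zeroʳ c)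

  module _ (y : ℚ) where

    weight : ℕ → ∀ {n} → Perm n → ℚ
    weight j π = ⟦ exc π ≟ j ⟧ powℚ y (cyc π)

    eulerian : ℕ → ℕ → ℚ
    eulerian n j = ∑ℚ (weight j) (Sym n)

    Fcoeff≡eulerian : ∀ n j → Fcoeff n y j ≡ eulerian n j
    Fcoeff≡eulerian zero    zero    = refl
    Fcoeff≡eulerian zero    (suc j) = refl
    Fcoeff≡eulerian (suc n) j       = ∑ℚ-filterᵇ (λ π → powℚ y (cyc π)) (λ π → exc π ≡ᵇ j) (Sym (suc n))

    shifted : ℕ → ℕ → ∀ {m} → Perm m → ℚ
    shifted n zero    σ = 0ℚ
    shifted n (suc i) σ = (ℕ→ℚ n - ℕ→ℚ i) * weight i σ

    weight-insert-fixed : ∀ {n} j (σ : Perm n) → IsPerm σ →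
                          weight j (insert σ nothing) ≡ y * ⟦ exc σ ≟ j ⟧ powℚ y (cyc σ)
    weight-insert-fixed j σ σ-inj rewrite exc-insert-fixed σ | cyc-insert-fixed σ σ-inj | ℕP.+-comm (cyc σ) 1 =
      ⟦≟⟧-scale y (exc σ) j (powℚ y (cyc σ))

    weight-insert-after : ∀ {n} j (σ : Perm n) i → IsPerm σ → weight j (insert σ (just i)) ≡
      (if isExc σ i then ⟦ exc σ ≟ j ⟧ powℚ y (cyc σ) else ⟦ suc (exc σ) ≟ j ⟧ powℚ y (cyc σ))
    weight-insert-after j σ i σ-inj with isExc σ i | exc-insert-after σ i
    ... | true  | exc-eq rewrite ℕP.+-cancelʳ-≡ 1 _ _ exc-eq | cyc-insert-after σ i σ-inj = refl
    ... | false | exc-eq rewrite ℕP.+-identityʳ (exc (insert σ (just i))) | exc-eq | ℕP.+-comm (exc σ) 1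
                               | cyc-insert-after σ i σ-inj = refl

    -- Of the n + 1 insertions into σ, the fixed point adds a cycle, the exc σ insertions after an
    -- excedance keep both statistics, and the other n - exc σ add one excedance.
    ∑-insertions : ∀ {n} j (σ : Perm n) → IsPerm σ →
                   ∑ℚ (weight j ∘ insert σ) (insertionPoints n) ≡ (y + ℕ→ℚ j) * weight j σ + shifted n j σ
    ∑-insertions {n} j σ σ-inj = begin
      weight j (insert σ nothing) + ∑ℚ (weight j ∘ insert σ) (map just (allFin n))
        ≡⟨ cong₂ _+_ (weight-insert-fixed j σ σ-inj)
                     (trans (∑ℚ-map (weight j ∘ insert σ) just (allFin n))
                     (trans (∑ℚ-allFin (weight j ∘ insert σ ∘ just)) (∑Fin-cong (λ i → weight-insert-after j σ i σ-inj)))) ⟩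
      y * ⟦ e ≟ j ⟧ v + ∑Fin (λ i → if isExc σ i then ⟦ e ≟ j ⟧ v else ⟦ suc e ≟ j ⟧ v)
        ≡⟨ cong (y * ⟦ e ≟ j ⟧ v +_) (∑Fin-if (isExc σ) _ _) ⟩
      y * ⟦ e ≟ j ⟧ v + (ℕ→ℚ (countFin (isExc σ)) * ⟦ e ≟ j ⟧ v + ℕ→ℚ (countFin (not ∘ isExc σ)) * ⟦ suc e ≟ j ⟧ v)
        ≡⟨ cong₂ (λ a b → y * ⟦ e ≟ j ⟧ v + (ℕ→ℚ a * ⟦ e ≟ j ⟧ v + b * ⟦ suc e ≟ j ⟧ v))
                 (sym (exc≡countFin σ)) non-excedances ⟩
      y * ⟦ e ≟ j ⟧ v + (ℕ→ℚ e * ⟦ e ≟ j ⟧ v + (ℕ→ℚ n - ℕ→ℚ e) * ⟦ suc e ≟ j ⟧ v)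
        ≡⟨ cong₂ (λ a b → y * ⟦ e ≟ j ⟧ v + (a + b)) (⟦≟⟧-coeff ℕ→ℚ e j v) (shift j) ⟩
      y * ⟦ e ≟ j ⟧ v + (ℕ→ℚ j * ⟦ e ≟ j ⟧ v + shifted n j σ)
        ≡⟨ solve 4 (λ y δ J S → y :* δ :+ (J :* δ :+ S) := (y :+ J) :* δ :+ S) refl y (⟦ e ≟ j ⟧ v) (ℕ→ℚ j) _ ⟩
      (y + ℕ→ℚ j) * weight j σ + shifted n j σ ∎
      where
      open ≡-Reasoning
      e = exc σ
      v = powℚ y (cyc σ)
      non-excedances : ℕ→ℚ (countFin (not ∘ isExc σ)) ≡ ℕ→ℚ n - ℕ→ℚ e
      non-excedances = trans (solve 2 (λ a b → b := (a :+ b) :- a) refl (ℕ→ℚ e) (ℕ→ℚ k))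
        (cong (_- ℕ→ℚ e) (trans (sym (ℕ→ℚ-+ e k))
          (cong ℕ→ℚ (trans (cong (ℕ._+ k) (exc≡countFin σ)) (countFin-complement (isExc σ))))))
        where k = countFin (not ∘ isExc σ)
      shift : ∀ j → (ℕ→ℚ n - ℕ→ℚ e) * ⟦ suc e ≟ j ⟧ v ≡ shifted n j σ
      shift zero    = ℚP.*-zeroʳ (ℕ→ℚ n - ℕ→ℚ e)
      shift (suc i) = ⟦≟⟧-coeff (λ m → ℕ→ℚ n - ℕ→ℚ m) e i v

    eulerian-suc : ∀ n j → eulerian (suc n) j ≡ (y + ℕ→ℚ j) * eulerian n j + ∑ℚ (shifted n j) (Sym n)
    eulerian-suc n j = begin
      ∑ℚ (weight j) (Sym (suc n))
        ≡⟨ ∑ℚ-↭ (weight j) (insertions↭Sym n) ⟨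
      ∑ℚ (weight j) (insertions n)
        ≡⟨ ∑ℚ-cartesianProductWith (weight j) insert (Sym n) _ ⟩
      ∑ℚ (λ σ → ∑ℚ (weight j ∘ insert σ) (insertionPoints n)) (Sym n)
        ≡⟨ ∑ℚ-cong-∈ (Sym n) (λ σ σ∈ → ∑-insertions j σ (∈-Sym⁻ σ∈)) ⟩
      ∑ℚ (λ σ → (y + ℕ→ℚ j) * weight j σ + shifted n j σ) (Sym n)
        ≡⟨ ∑ℚ-affine (y + ℕ→ℚ j) (weight j) (shifted n j) (Sym n) ⟩
      (y + ℕ→ℚ j) * eulerian n j + ∑ℚ (shifted n j) (Sym n) ∎
      where open ≡-Reasoning

    eulerian-suc-zero : ∀ n → eulerian (suc n) 0 ≡ (y + ℕ→ℚ 0) * eulerian n 0 + 0ℚ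
    eulerian-suc-zero n = trans (eulerian-suc n 0) (cong ((y + ℕ→ℚ 0) * eulerian n 0 +_) (∑ℚ-zero (Sym n)))

    eulerian-suc-suc : ∀ n i → eulerian (suc n) (suc i) ≡
                       (y + ℕ→ℚ (suc i)) * eulerian n (suc i) + (ℕ→ℚ n - ℕ→ℚ i) * eulerian n i
    eulerian-suc-suc n i = trans (eulerian-suc n (suc i))
      (cong ((y + ℕ→ℚ (suc i)) * eulerian n (suc i) +_) (∑ℚ-distribˡ (ℕ→ℚ n - ℕ→ℚ i) (weight i) (Sym n)))

open import Data.Nat using (ℕ; zero; suc)
open import Data.Integer as ℤ using (+_)
open import Data.Rational using (ℚ; 0ℚ; 1ℚ; ½; _*_; _+_; _-_)
open import Data.Rational.Solver using (module +-*-Solver)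
open +-*-Solver using (solve; _:=_; _:+_; _:*_; _:-_; con)
open import Data.Product using (_×_; _,_)
import Data.Rational
open import Relation.Binary.PropositionalEquality
open import Defs
open GeneratingFunctionIdentity
open QCoefficients
open IntegerCast
open EulerianCoefficients

private
  2ℚ : ℚ
  2ℚ = ℤ→ℚ (+ 2)

qq≡2ⁿ*eulerian : ∀ n j → ℤ→ℚ (qq n j) ≡ powℚ 2ℚ n * eulerian ½ n j
qq≡2ⁿ*eulerian zero    zero    = refl
qq≡2ⁿ*eulerian zero    (suc j) = refl
qq≡2ⁿ*eulerian (suc n) zero    = begin
  ℤ→ℚ (qq (suc n) 0)                             ≡⟨ cong ℤ→ℚ (qq-suc-coeff-zero n) ⟩
  ℤ→ℚ (qq n 0)                                   ≡⟨ qq≡2ⁿ*eulerian n 0 ⟩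
  powℚ 2ℚ n * eulerian ½ n 0
    ≡⟨ solve 2 (λ T G → T :* G := (con 2ℚ :* T) :* ((con ½ :+ con (ℕ→ℚ 0)) :* G :+ con 0ℚ)) refl
             (powℚ 2ℚ n) (eulerian ½ n 0) ⟩
  (2ℚ * powℚ 2ℚ n) * ((½ + ℕ→ℚ 0) * eulerian ½ n 0 + 0ℚ)
    ≡⟨ cong (2ℚ * powℚ 2ℚ n *_) (eulerian-suc-zero ½ n) ⟨
  powℚ 2ℚ (suc n) * eulerian ½ (suc n) 0 ∎
  where open ≡-Reasoning
qq≡2ⁿ*eulerian (suc n) (suc i) = begin
  ℤ→ℚ (qq (suc n) (suc i))
    ≡⟨ cong ℤ→ℚ (qq-suc-coeff-suc n i) ⟩
  ℤ→ℚ ((+ 1 ℤ.+ + 2 ℤ.* + suc i) ℤ.* qq n (suc i) ℤ.+ + 2 ℤ.* (+ n ℤ.- + i) ℤ.* qq n i)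
    ≡⟨ cast ⟩
  (1ℚ + 2ℚ * ℕ→ℚ (suc i)) * ℤ→ℚ (qq n (suc i)) + 2ℚ * (ℕ→ℚ n - ℕ→ℚ i) * ℤ→ℚ (qq n i)
    ≡⟨ cong₂ (λ a b → (1ℚ + 2ℚ * ℕ→ℚ (suc i)) * a + 2ℚ * (ℕ→ℚ n - ℕ→ℚ i) * b)
             (qq≡2ⁿ*eulerian n (suc i)) (qq≡2ⁿ*eulerian n i) ⟩
  (1ℚ + 2ℚ * ℕ→ℚ (suc i)) * (powℚ 2ℚ n * eulerian ½ n (suc i))
    + 2ℚ * (ℕ→ℚ n - ℕ→ℚ i) * (powℚ 2ℚ n * eulerian ½ n i)
    ≡⟨ solve 6 (λ T A B S N I → (con 1ℚ :+ con 2ℚ :* S) :* (T :* A) :+ con 2ℚ :* (N :- I) :* (T :* B)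
                                := (con 2ℚ :* T) :* ((con ½ :+ S) :* A :+ (N :- I) :* B))
             refl (powℚ 2ℚ n) (eulerian ½ n (suc i)) (eulerian ½ n i) (ℕ→ℚ (suc i)) (ℕ→ℚ n) (ℕ→ℚ i) ⟩
  (2ℚ * powℚ 2ℚ n) * ((½ + ℕ→ℚ (suc i)) * eulerian ½ n (suc i) + (ℕ→ℚ n - ℕ→ℚ i) * eulerian ½ n i)
    ≡⟨ cong (2ℚ * powℚ 2ℚ n *_) (eulerian-suc-suc ½ n i) ⟨
  powℚ 2ℚ (suc n) * eulerian ½ (suc n) (suc i) ∎
  where
  open ≡-Reasoning
  a = (+ 1 ℤ.+ + 2 ℤ.* + suc i) ℤ.* qq n (suc i)
  b = + 2 ℤ.* (+ n ℤ.- + i) ℤ.* qq n i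
  cast : ℤ→ℚ (a ℤ.+ b) ≡ (1ℚ + 2ℚ * ℕ→ℚ (suc i)) * ℤ→ℚ (qq n (suc i)) + 2ℚ * (ℕ→ℚ n - ℕ→ℚ i) * ℤ→ℚ (qq n i)
  cast = trans (ℤ→ℚ-+ a b) (cong₂ _+_
    (trans (ℤ→ℚ-* (+ 1 ℤ.+ + 2 ℤ.* + suc i) (qq n (suc i)))
           (cong (_* ℤ→ℚ (qq n (suc i))) (trans (ℤ→ℚ-+ (+ 1) (+ 2 ℤ.* + suc i)) (cong (_+_ 1ℚ) (ℤ→ℚ-* (+ 2) (+ suc i))))))
    (trans (ℤ→ℚ-* (+ 2 ℤ.* (+ n ℤ.- + i)) (qq n i))
           (cong (_* ℤ→ℚ (qq n i)) (trans (ℤ→ℚ-* (+ 2) (+ n ℤ.- + i)) (cong (2ℚ *_) (ℤ→ℚ-- (+ n) (+ i)))))))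

mainTheorem1 : (Q 0 ≈ₚ constP (+ 1)) ×
    (∀ n → ((Q ⋆ Q) ⋆ expEGF) n -ₚ (xP *ₚ (Q ⋆ Q) n)
    ≈ₚ constEGF (constP (+ 1) -ₚ xP) n) ×
    (∀ n j → Data.Rational._/_ (Q n j) 1 ≡ powℚ (Data.Rational._/_ (+ 2) 1) n * Fcoeff n ½ j)
mainTheorem1 =
  (λ _ → refl) ,
  Q²E-xQ²≡1-x ,
  λ n j → trans (qq≡2ⁿ*eulerian n j) (cong (powℚ 2ℚ n *_) (sym (Fcoeff≡eulerian ½ n j)))
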